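{- Let $n\geq 4$ and, for $\pi\in\mathcal{S}_n$, define $\mathtt{f_2}(\pi)=\sum_{\sigma\in\mathcal{S}_n}\mathtt{inv_X}(\sigma^{ -1})\,\mathtt{inv_X}(\sigma\pi)$, $\mathtt{f_3}(\pi)=\sum_{\sigma,\tau\in\mathcal{S}_n}\mathtt{inv_X}(\sigma^{ -1})\,\mathtt{inv_X}(\sigma\tau^{ -1})\,\mathtt{inv_X}(\tau\pi)$, $\mathtt{f}(\pi)=\Lambda\Delta\,\mathtt{inv_X}(\pi)+(\Lambda+\Delta)\,\mathtt{f_2}(\pi)+\mathtt{f_3}(\pi)$, where $\Lambda=(n-2)!\sum_{1\le i<j\le n}(j-i)X_{i,j}$ and $\Delta=(n-3)!\sum_{1\le i<j\le n}(n-2(j-i))X_{i,j}$. Then for every $\pi\in\mathcal{S}_n$, $$\mathtt{f}(\pi)=\mathtt{f}(\iota)=(\Lambda+\Delta)\,\mathtt{f_2}(\iota)+\mathtt{f_3}(\iota),$$ where $\iota$ is the identity permutation.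
   Context: $\mathcal{S}_n$ is the symmetric group on $[n]$ with product given by composition; $\mathtt{inv_X}(\sigma)=\sum_{i<j,\ \sigma(i)>\sigma(j)}X_{i,j}\in\mathbb{R}[X_{i,j}:1\le i<j\le n]$. -}

module Defs where

open import Level using (Level)
open import Algebra.Bundles using (CommutativeRing)
open import Data.Nat.Base using (ℕ; zero; suc; _∸_; _!)
open import Data.Integer.Base using (ℤ; +_; -[1+_]) renaming (_-_ to _-ℤ_; _*_ to _*ℤ_)
open import Data.Fin.Base using (Fin; zero; suc; toℕ; _<_)
open import Data.Fin.Properties using (_≟_; _<?_; all?)
open import Data.Fin.Permutation using (Permutation′; permutation; _⟨$⟩ʳ_; _∘ₚ_; flip; id)
open import Data.List.Base using (List; []; _∷_; map; concatMap; cartesianProduct; mapMaybe; foldr)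
open import Data.List using (allFin)
open import Data.Maybe.Base using (Maybe; just; nothing)
open import Data.Product.Base using (_×_; _,_)
open import Relation.Nullary using (yes; no; does)
open import Data.Bool.Base using (if_then_else_; _∧_)
open import Relation.Binary.PropositionalEquality using (_≡_; refl)

allFuns : (m k : ℕ) → List (Fin m → Fin k)
allFuns zero    k = (λ ()) ∷ []
allFuns (suc m) k =
  concatMap (λ a → map (λ f → λ { zero → a ; (suc i) → f i }) (allFuns m k)) (allFin k)

toPerm : {n : ℕ} → (Fin n → Fin n) × (Fin n → Fin n) → Maybe (Permutation′ n)
toPerm (f , g) with all? (λ y → f (g y) ≟ y) | all? (λ x → g (f x) ≟ x)
... | yes fg | yes gf = just (permutation f g fg gf)
... | _      | _      = nothing

-- the list of all elements of S_n (each permutation occurs exactly once,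
-- since a bijection determines its inverse)
Sym : (n : ℕ) → List (Permutation′ n)
Sym n = mapMaybe toPerm (cartesianProduct (allFuns n n) (allFuns n n))

_·_ : {n : ℕ} → Permutation′ n → Permutation′ n → Permutation′ n
σ · π = π ∘ₚ σ

·-is-composition : {n : ℕ} (σ π : Permutation′ n) (i : Fin n) →
                   (σ · π) ⟨$⟩ʳ i ≡ σ ⟨$⟩ʳ (π ⟨$⟩ʳ i)
·-is-composition σ π i = refl

_⁻¹ : {n : ℕ} → Permutation′ n → Permutation′ n
σ ⁻¹ = flip σ

ι : {n : ℕ} → Permutation′ n
ι = id

-- The polynomials, evaluated in an arbitrary commutative ring R at an
-- arbitrary assignment X i j of the variables X_{i,j} (only i < j is used).

module Poly {c ℓ : Level} (R : CommutativeRing c ℓ) where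
  open CommutativeRing R

  natR : ℕ → Carrier
  natR zero    = 0#
  natR (suc k) = 1# + natR k

  intR : ℤ → Carrier
  intR (+ k)      = natR k
  intR -[1+ k ]   = - natR (suc k)

  ΣR : {A : Set} → List A → (A → Carrier) → Carrier
  ΣR xs f = foldr (λ a r → f a + r) 0# xs

  Σpairs : {n : ℕ} → (Fin n → Fin n → Carrier) → Carrier
  Σpairs {n} g = ΣR (cartesianProduct (allFin n) (allFin n))
    (λ { (i , j) → if does (i <? j) then g i j else 0# })

  module _ {n : ℕ} (X : Fin n → Fin n → Carrier) where

    invX : Permutation′ n → Carrier
    invX σ = Σpairs (λ i j → if does ((σ ⟨$⟩ʳ j) <? (σ ⟨$⟩ʳ i)) then X i j else 0#)

    f₂ : Permutation′ n → Carrier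
    f₂ π = ΣR (Sym n) (λ σ → invX (σ ⁻¹) * invX (σ · π))

    f₃ : Permutation′ n → Carrier
    f₃ π = ΣR (Sym n) (λ σ → ΣR (Sym n) (λ τ →
             invX (σ ⁻¹) * invX (σ · (τ ⁻¹)) * invX (τ · π)))

    Λ : Carrier
    Λ = natR ((n ∸ 2) !) * Σpairs (λ i j → natR (toℕ j ∸ toℕ i) * X i j)

    Δ : Carrier
    Δ = natR ((n ∸ 3) !) *
        Σpairs (λ i j → intR (+ n -ℤ (+ 2 *ℤ + (toℕ j ∸ toℕ i))) * X i j)

    f : Permutation′ n → Carrier
    f π = Λ * Δ * invX π + (Λ + Δ) * f₂ π + f₃ π

module Submission where

-- With W i j = [i<j]·X i j, g a b = [b<a] and L H π = Σ_{i,j} W i j · H (π i) (π j)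
-- we have inv_X = L g.  For (T H) a b = Σ_σ inv_X(σ⁻¹) · H (σ a) (σ b) one gets
-- f₂ = L (T g) and f₃ = L (T (T g)), so f = L K with K = ΛΔ·g + (Λ+Δ)·T g + T (T g),
-- and L K π does not depend on π once K is constant off the diagonal.  This
-- follows from two identities, with w a b = a − b and B = (n-3)! Σ_{i<j} (j-i-1) X i j:
--   (1)  T g a b + Δ·g a b + B·w a b = E₀ for all a ≢ b,      (2)  T w = −Λ·w.
-- Both are proved by moving a and b in steps v ↦ v+1: replacing σ by σ ∘ (v v+1)
-- changes inv_X(σ⁻¹) by ±X at the pair {σ v , σ (v+1)}, and the resulting
-- correction sums over S_n are evaluated by counting the permutations with two
-- or three prescribed values.

open import Level using (Level)
open import Algebra.Bundles using (CommutativeRing)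
open import Data.Nat.Base as ℕ using (ℕ; zero; suc; _∸_; _!; _≤_; z≤n; s≤s)
import Data.Nat.Properties as ℕP
open import Data.Integer.Base as ℤ using (ℤ; -[1+_]; _⊖_; _◃_; sign; ∣_∣)
import Data.Integer.Properties as ℤP
open import Data.Sign.Base as Sign using (Sign)
open import Data.Fin.Base using (Fin; zero; suc; toℕ; fromℕ<; punchIn; punchOut)
import Data.Fin.Properties as FinP
open FinP using (_≟_; _<?_; all?)
open import Data.Fin.Permutation
  using (Permutation′; permutation; _⟨$⟩ʳ_; _⟨$⟩ˡ_; inverseˡ; inverseʳ; transpose; insert; remove;
         insert-punchIn; punchIn-permute)
  renaming (_≈_ to _≈ₚ_)
open import Data.List.Base using (List; []; _∷_; map; _++_; concat; concatMap; cartesianProduct; mapMaybe; tabulate)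
open import Data.List using (allFin)
open import Data.Vec.Functional using () renaming (_∷_ to cons)
open import Data.Maybe.Base using (Maybe; just; nothing)
open import Data.Product.Base using (_×_; _,_; proj₁; proj₂)
open import Data.Sum.Base using (inj₁; inj₂)
open import Data.Empty using (⊥-elim)
open import Data.Bool.Base using (if_then_else_)
open import Relation.Nullary using (Dec; yes; no; does; ¬_)
open import Relation.Nullary.Decidable using (dec-true; dec-false; ¬?)
open import Relation.Binary.Definitions using (tri<; tri≈; tri>)
open import Relation.Binary.PropositionalEquality as P using (_≡_; _≢_)
open import Function.Base using (_∘_)
import Algebra.Solver.Ring.AlmostCommutativeRing as ACR
import Algebra.Solver.Ring
open import Defs

-- The integers and natural numbers inside R: natR and intR are ring
-- homomorphisms.  This is what lets the ring solver (with integer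
-- coefficients) be used for the routine algebra below.
module RingArithmetic {c ℓ : Level} (R : CommutativeRing c ℓ) where
  open CommutativeRing R hiding (zero)
  open Poly R
  open import Relation.Binary.Reasoning.Setoid setoid
  open import Algebra.Properties.Ring ring public
    using (-‿distribˡ-*; -‿distribʳ-*; -‿involutive; -‿+-comm; -0#≈0#)

  natR-+ : ∀ m n → natR (m ℕ.+ n) ≈ natR m + natR n
  natR-+ zero    n = sym (+-identityˡ _)
  natR-+ (suc m) n = trans (+-cong refl (natR-+ m n)) (sym (+-assoc _ _ _))

  natR-* : ∀ m n → natR (m ℕ.* n) ≈ natR m * natR n
  natR-* zero    n = sym (zeroˡ _)
  natR-* (suc m) n = begin
    natR (n ℕ.+ m ℕ.* n)            ≈⟨ natR-+ n (m ℕ.* n) ⟩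
    natR n + natR (m ℕ.* n)         ≈⟨ +-cong (sym (*-identityˡ _)) (natR-* m n) ⟩
    1# * natR n + natR m * natR n   ≈⟨ sym (distribʳ _ _ _) ⟩
    (1# + natR m) * natR n          ∎

  sgnR : Sign → Carrier
  sgnR Sign.+ = 1#
  sgnR Sign.- = - 1#

  sgnR-* : ∀ s t → sgnR (s Sign.* t) ≈ sgnR s * sgnR t
  sgnR-* Sign.- Sign.- = sym (trans (sym (-‿distribˡ-* _ _)) (trans (-‿cong (*-identityˡ _)) (-‿involutive _)))
  sgnR-* Sign.- Sign.+ = sym (*-identityʳ _)
  sgnR-* Sign.+ Sign.- = sym (*-identityˡ _)
  sgnR-* Sign.+ Sign.+ = sym (*-identityˡ _)

  intR-◃ : ∀ s k → intR (s ◃ k) ≈ sgnR s * natR k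
  intR-◃ Sign.- zero    = sym (zeroʳ _)
  intR-◃ Sign.+ zero    = sym (zeroʳ _)
  intR-◃ Sign.+ (suc k) = sym (*-identityˡ _)
  intR-◃ Sign.- (suc k) = trans (-‿cong (sym (*-identityˡ _))) (-‿distribˡ-* _ _)

  intR-sign-abs : ∀ i → intR i ≈ sgnR (sign i) * natR ∣ i ∣
  intR-sign-abs i = trans (reflexive (P.cong intR (P.sym (ℤP.◃-inverse i)))) (intR-◃ (sign i) ∣ i ∣)

  intR-* : ∀ i j → intR (i ℤ.* j) ≈ intR i * intR j
  intR-* i j = begin
    intR (i ℤ.* j)                                         ≈⟨ intR-◃ (sign i Sign.* sign j) (∣ i ∣ ℕ.* ∣ j ∣) ⟩
    sgnR (sign i Sign.* sign j) * natR (∣ i ∣ ℕ.* ∣ j ∣)   ≈⟨ *-cong (sgnR-* (sign i) (sign j)) (natR-* ∣ i ∣ ∣ j ∣) ⟩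
    (sgnR (sign i) * sgnR (sign j)) * (natR ∣ i ∣ * natR ∣ j ∣) ≈⟨ interchange _ _ _ _ ⟩
    (sgnR (sign i) * natR ∣ i ∣) * (sgnR (sign j) * natR ∣ j ∣) ≈⟨ sym (*-cong (intR-sign-abs i) (intR-sign-abs j)) ⟩
    intR i * intR j                                        ∎
    where open import Algebra.Properties.CommutativeSemigroup *-commutativeSemigroup using (interchange)

  intR-⊖ : ∀ m n → intR (m ⊖ n) ≈ natR m - natR n
  intR-⊖ m zero = begin
    intR (m ⊖ zero) ≡⟨ P.cong intR (ℤP.⊖-≥ {m} {zero} z≤n) ⟩
    natR m          ≈⟨ sym (+-identityʳ _) ⟩
    natR m + 0#     ≈⟨ +-cong refl (sym -0#≈0#) ⟩
    natR m - 0#     ∎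
  intR-⊖ zero    (suc n) = sym (+-identityˡ _)
  intR-⊖ (suc m) (suc n) = begin
    intR (suc m ⊖ suc n)            ≡⟨ P.cong intR (ℤP.[1+m]⊖[1+n]≡m⊖n m n) ⟩
    intR (m ⊖ n)                    ≈⟨ intR-⊖ m n ⟩
    natR m - natR n                 ≈⟨ cancel-1 ⟩
    (1# + natR m) - (1# + natR n)   ∎
    where
    cancel-1 : natR m - natR n ≈ (1# + natR m) - (1# + natR n)
    cancel-1 = begin
      natR m - natR n                   ≈⟨ sym (+-identityˡ _) ⟩
      0# + (natR m - natR n)            ≈⟨ +-cong (sym (-‿inverseʳ 1#)) refl ⟩
      (1# - 1#) + (natR m - natR n)     ≈⟨ +-assoc _ _ _ ⟩
      1# + (- 1# + (natR m - natR n))   ≈⟨ +-cong refl (sym (+-assoc _ _ _)) ⟩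
      1# + ((- 1# + natR m) - natR n)   ≈⟨ +-cong refl (+-cong (+-comm _ _) refl) ⟩
      1# + ((natR m - 1#) - natR n)     ≈⟨ +-cong refl (+-assoc _ _ _) ⟩
      1# + (natR m + (- 1# - natR n))   ≈⟨ sym (+-assoc _ _ _) ⟩
      (1# + natR m) + (- 1# - natR n)   ≈⟨ +-cong refl (-‿+-comm 1# (natR n)) ⟩
      (1# + natR m) - (1# + natR n)     ∎

  intR-+ : ∀ i j → intR (i ℤ.+ j) ≈ intR i + intR j
  intR-+ (ℤ.+ m)   (ℤ.+ n)   = natR-+ m n
  intR-+ (ℤ.+ m)   -[1+ n ]  = intR-⊖ m (suc n)
  intR-+ -[1+ m ]  (ℤ.+ n)   = trans (intR-⊖ n (suc m)) (+-comm _ _)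
  intR-+ -[1+ m ]  -[1+ n ]  = begin
    - (1# + (1# + natR (m ℕ.+ n)))      ≈⟨ -‿cong (+-cong refl (trans (+-cong refl (natR-+ m n)) (sym (+-assoc _ _ _)))) ⟩
    - (1# + ((1# + natR m) + natR n))   ≈⟨ -‿cong (trans (sym (+-assoc _ _ _)) (+-cong (+-comm _ _) refl)) ⟩
    - (((1# + natR m) + 1#) + natR n)   ≈⟨ -‿cong (+-assoc _ _ _) ⟩
    - ((1# + natR m) + (1# + natR n))   ≈⟨ sym (-‿+-comm _ _) ⟩
    - (1# + natR m) - (1# + natR n)     ∎

  intR-neg : ∀ i → intR (ℤ.- i) ≈ - intR i
  intR-neg (ℤ.+ zero)  = sym -0#≈0#
  intR-neg (ℤ.+ suc n) = refl
  intR-neg -[1+ n ]  = sym (-‿involutive _)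

  -- intR, adjusted so that the coefficient 1 is sent to 1# on the nose;
  -- the solver then proves identities stated with 1# directly.
  coeffR : ℤ → Carrier
  coeffR (ℤ.+ suc zero) = 1#
  coeffR i              = intR i

  coeffR≈intR : ∀ i → coeffR i ≈ intR i
  coeffR≈intR (ℤ.+ zero)        = refl
  coeffR≈intR (ℤ.+ suc zero)    = sym (+-identityʳ 1#)
  coeffR≈intR (ℤ.+ suc (suc n)) = refl
  coeffR≈intR -[1+ n ]          = refl

  coeffR-homomorphism : ℤ.+-*-rawRing ACR.-Raw-AlmostCommutative⟶ ACR.fromCommutativeRing R
  coeffR-homomorphism = record
    { ⟦_⟧    = coeffR
    ; +-homo = λ i j → via (i ℤ.+ j) (intR-+ i j) (+-cong (coeffR≈intR i) (coeffR≈intR j))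
    ; *-homo = λ i j → via (i ℤ.* j) (intR-* i j) (*-cong (coeffR≈intR i) (coeffR≈intR j))
    ; -‿homo = λ i → via (ℤ.- i) (intR-neg i) (-‿cong (coeffR≈intR i))
    ; 0-homo = refl
    ; 1-homo = refl
    }
    where
    via : ∀ k {x y} → intR k ≈ x → y ≈ x → coeffR k ≈ y
    via k e e′ = trans (coeffR≈intR k) (trans e (sym e′))

  coeffR-≟ : ∀ i j → Maybe (coeffR i ≈ coeffR j)
  coeffR-≟ i j with i ℤP.≟ j
  ... | yes i≡j = just (reflexive (P.cong coeffR i≡j))
  ... | no  _   = nothing

  module Solver = Algebra.Solver.Ring ℤ.+-*-rawRing (ACR.fromCommutativeRing R) coeffR-homomorphism coeffR-≟

module FiniteSums {c ℓ : Level} (R : CommutativeRing c ℓ) where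
  open CommutativeRing R hiding (zero)
  open Poly R
  open RingArithmetic R
  open import Relation.Binary.Reasoning.Setoid setoid

  𝟙 : ∀ {p} {Q : Set p} → Dec Q → Carrier
  𝟙 d = if does d then 1# else 0#

  𝟙-yes : ∀ {p} {Q : Set p} (d : Dec Q) → Q → 𝟙 d ≈ 1#
  𝟙-yes (yes _) q = refl
  𝟙-yes (no ¬q) q = ⊥-elim (¬q q)

  𝟙-no : ∀ {p} {Q : Set p} (d : Dec Q) → ¬ Q → 𝟙 d ≈ 0#
  𝟙-no (yes q) ¬q = ⊥-elim (¬q q)
  𝟙-no (no _)  ¬q = refl

  𝟙-iff : ∀ {p q} {A : Set p} {B : Set q} (d : Dec A) (e : Dec B) → (A → B) → (B → A) → 𝟙 d ≈ 𝟙 e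
  𝟙-iff (yes a) e f g = sym (𝟙-yes e (f a))
  𝟙-iff (no ¬a) e f g = sym (𝟙-no e (λ b → ¬a (g b)))

  𝟙-by : ∀ {p} {A : Set p} (d : Dec A) {x : Carrier} → (A → x ≈ 1#) → (¬ A → x ≈ 0#) → x ≈ 𝟙 d
  𝟙-by (yes a) f g = f a
  𝟙-by (no ¬a) f g = g ¬a

  𝟙-∧ : ∀ {p q r} {A : Set p} {B : Set q} {C : Set r} (d : Dec A) (e₁ : Dec B) (e₂ : Dec C) →
        (A → B) → (A → C) → (B → C → A) → 𝟙 d ≈ 𝟙 e₁ * 𝟙 e₂
  𝟙-∧ d (yes b) (yes c) f g h = trans (𝟙-yes d (h b c)) (sym (*-identityˡ _))
  𝟙-∧ d (yes b) (no ¬c) f g h = trans (𝟙-no d (λ a → ¬c (g a))) (sym (zeroʳ _))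
  𝟙-∧ d (no ¬b) e₂      f g h = trans (𝟙-no d (λ a → ¬b (f a))) (sym (zeroˡ _))

  𝟙-guard : ∀ {p} {A : Set p} (d : Dec A) {x y : Carrier} → (A → x ≈ y) → 𝟙 d * x ≈ 𝟙 d * y
  𝟙-guard (yes a) f = *-cong refl (f a)
  𝟙-guard (no _)  f = trans (zeroˡ _) (sym (zeroˡ _))

  𝟙-disjoint : ∀ {p q} {A : Set p} {B : Set q} (d : Dec A) (e : Dec B) → (A → ¬ B) → 𝟙 d * 𝟙 e ≈ 0#
  𝟙-disjoint d e h = trans (𝟙-guard d (λ a → 𝟙-no e (h a))) (zeroʳ _)

  if-as-𝟙 : ∀ {p} {Q : Set p} (d : Dec Q) (x : Carrier) → (if does d then x else 0#) ≈ 𝟙 d * x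
  if-as-𝟙 (yes _) x = sym (*-identityˡ x)
  if-as-𝟙 (no _)  x = sym (zeroˡ x)

  module _ {A : Set} where
    ΣR-cong : (xs : List A) {f g : A → Carrier} → (∀ x → f x ≈ g x) → ΣR xs f ≈ ΣR xs g
    ΣR-cong []       e = refl
    ΣR-cong (x ∷ xs) e = +-cong (e x) (ΣR-cong xs e)

    ΣR-0 : (xs : List A) {f : A → Carrier} → (∀ x → f x ≈ 0#) → ΣR xs f ≈ 0#
    ΣR-0 []       e = refl
    ΣR-0 (x ∷ xs) e = trans (+-cong (e x) (ΣR-0 xs e)) (+-identityˡ _)

    ΣR-+ : (xs : List A) (f g : A → Carrier) → ΣR xs (λ x → f x + g x) ≈ ΣR xs f + ΣR xs g
    ΣR-+ []       f g = sym (+-identityˡ 0#)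
    ΣR-+ (x ∷ xs) f g = begin
      (f x + g x) + ΣR xs (λ x → f x + g x) ≈⟨ +-cong refl (ΣR-+ xs f g) ⟩
      (f x + g x) + (ΣR xs f + ΣR xs g)     ≈⟨ interchange _ _ _ _ ⟩
      (f x + ΣR xs f) + (g x + ΣR xs g)     ∎
      where open import Algebra.Properties.CommutativeSemigroup +-commutativeSemigroup using (interchange)

    ΣR-*ˡ : (xs : List A) (k : Carrier) (f : A → Carrier) → k * ΣR xs f ≈ ΣR xs (λ x → k * f x)
    ΣR-*ˡ []       k f = zeroʳ k
    ΣR-*ˡ (x ∷ xs) k f = trans (distribˡ _ _ _) (+-cong refl (ΣR-*ˡ xs k f))

    ΣR-*ʳ : (xs : List A) (k : Carrier) (f : A → Carrier) → ΣR xs f * k ≈ ΣR xs (λ x → f x * k)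
    ΣR-*ʳ []       k f = zeroˡ k
    ΣR-*ʳ (x ∷ xs) k f = trans (distribʳ _ _ _) (+-cong refl (ΣR-*ʳ xs k f))

    ΣR-neg : (xs : List A) (f : A → Carrier) → ΣR xs (λ x → - f x) ≈ - ΣR xs f
    ΣR-neg []       f = sym -0#≈0#
    ΣR-neg (x ∷ xs) f = trans (+-cong refl (ΣR-neg xs f)) (-‿+-comm _ _)

    ΣR-- : (xs : List A) (f g : A → Carrier) → ΣR xs (λ x → f x - g x) ≈ ΣR xs f - ΣR xs g
    ΣR-- xs f g = trans (ΣR-+ xs f (λ x → - g x)) (+-cong refl (ΣR-neg xs g))

    ΣR-++ : (xs ys : List A) (f : A → Carrier) → ΣR (xs ++ ys) f ≈ ΣR xs f + ΣR ys f
    ΣR-++ []       ys f = sym (+-identityˡ _)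
    ΣR-++ (x ∷ xs) ys f = trans (+-cong refl (ΣR-++ xs ys f)) (sym (+-assoc _ _ _))

  ΣR-map : {A B : Set} (g : A → B) (xs : List A) (f : B → Carrier) → ΣR (map g xs) f ≡ ΣR xs (f ∘ g)
  ΣR-map g []       f = P.refl
  ΣR-map g (x ∷ xs) f = P.cong (f (g x) +_) (ΣR-map g xs f)

  maybeR : {B : Set} → Maybe B → (B → Carrier) → Carrier
  maybeR nothing  f = 0#
  maybeR (just y) f = f y

  module _ {A B : Set} where
    ΣR-swap : (xs : List A) (ys : List B) (F : A → B → Carrier) →
              ΣR xs (λ x → ΣR ys (λ y → F x y)) ≈ ΣR ys (λ y → ΣR xs (λ x → F x y))
    ΣR-swap []       ys F = sym (ΣR-0 ys (λ _ → refl))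
    ΣR-swap (x ∷ xs) ys F = trans (+-cong refl (ΣR-swap xs ys F)) (sym (ΣR-+ ys (F x) _))

    ΣR-cart : (xs : List A) (ys : List B) (F : A × B → Carrier) →
              ΣR (cartesianProduct xs ys) F ≈ ΣR xs (λ x → ΣR ys (λ y → F (x , y)))
    ΣR-cart []       ys F = refl
    ΣR-cart (x ∷ xs) ys F = begin
      ΣR (map (x ,_) ys ++ cartesianProduct xs ys) F       ≈⟨ ΣR-++ (map (x ,_) ys) _ F ⟩
      ΣR (map (x ,_) ys) F + ΣR (cartesianProduct xs ys) F ≈⟨ +-cong (reflexive (ΣR-map (x ,_) ys F)) (ΣR-cart xs ys F) ⟩
      ΣR ys (λ y → F (x , y)) + ΣR xs (λ x → ΣR ys (λ y → F (x , y))) ∎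

    ΣR-concatMap : (g : A → List B) (xs : List A) (f : B → Carrier) →
                   ΣR (concatMap g xs) f ≈ ΣR xs (λ x → ΣR (g x) f)
    ΣR-concatMap g []       f = refl
    ΣR-concatMap g (x ∷ xs) f = trans (ΣR-++ (g x) (concat (map g xs)) f) (+-cong refl (ΣR-concatMap g xs f))

    ΣR-mapMaybe : (p : A → Maybe B) (xs : List A) (f : B → Carrier) →
                  ΣR (mapMaybe p xs) f ≈ ΣR xs (λ x → maybeR (p x) f)
    ΣR-mapMaybe p []       f = refl
    ΣR-mapMaybe p (x ∷ xs) f with p x
    ... | nothing = trans (ΣR-mapMaybe p xs f) (sym (+-identityˡ _))
    ... | just y  = +-cong refl (ΣR-mapMaybe p xs f)

  ΣF : (n : ℕ) → (Fin n → Carrier) → Carrier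
  ΣF n G = ΣR (allFin n) G

  -- allFin is a tabulation, so a sum over Fin (suc n) splits off its first term
  ΣR-tabulate : ∀ {A : Set} n (f : Fin n → A) (G : A → Carrier) →
                ΣR (tabulate f) G ≡ ΣR (tabulate {n = n} (λ i → i)) (G ∘ f)
  ΣR-tabulate zero    f G = P.refl
  ΣR-tabulate (suc n) f G =
    P.cong (G (f zero) +_) (P.trans (ΣR-tabulate n (f ∘ suc) G) (P.sym (ΣR-tabulate n suc (G ∘ f))))

  ΣF-suc : ∀ n (G : Fin (suc n) → Carrier) → ΣF (suc n) G ≡ G zero + ΣF n (λ i → G (suc i))
  ΣF-suc n G = P.cong (G zero +_) (ΣR-tabulate n suc G)

  ΣF-const : ∀ n (x : Carrier) → ΣF n (λ _ → x) ≈ natR n * x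
  ΣF-const zero    x = sym (zeroˡ x)
  ΣF-const (suc n) x = begin
    ΣF (suc n) (λ _ → x) ≡⟨ ΣF-suc n _ ⟩
    x + ΣF n (λ _ → x)   ≈⟨ +-cong (sym (*-identityˡ x)) (ΣF-const n x) ⟩
    1# * x + natR n * x  ≈⟨ sym (distribʳ _ _ _) ⟩
    natR (suc n) * x     ∎

  sift : ∀ {n} (x : Fin n) (G : Fin n → Carrier) → ΣF n (λ i → 𝟙 (x ≟ i) * G i) ≈ G x
  sift {suc n} zero G = begin
    ΣF (suc n) (λ i → 𝟙 (zero ≟ i) * G i)  ≡⟨ ΣF-suc n _ ⟩
    1# * G zero + ΣF n (λ i → 0# * G (suc i)) ≈⟨ +-cong (*-identityˡ _) (ΣR-0 (allFin n) (λ i → zeroˡ _)) ⟩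
    G zero + 0#                             ≈⟨ +-identityʳ _ ⟩
    G zero                                  ∎
  sift {suc n} (suc x) G = begin
    ΣF (suc n) (λ i → 𝟙 (suc x ≟ i) * G i)                           ≡⟨ ΣF-suc n _ ⟩
    0# * G zero + ΣF n (λ i → 𝟙 (suc x ≟ suc i) * G (suc i))          ≈⟨ +-cong (zeroˡ _) (ΣR-cong (allFin n) shift) ⟩
    0# + ΣF n (λ i → 𝟙 (x ≟ i) * G (suc i))                          ≈⟨ +-identityˡ _ ⟩
    ΣF n (λ i → 𝟙 (x ≟ i) * G (suc i))                               ≈⟨ sift x (G ∘ suc) ⟩
    G (suc x)                                                        ∎
    where
    shift : ∀ i → 𝟙 (suc x ≟ suc i) * G (suc i) ≈ 𝟙 (x ≟ i) * G (suc i)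
    shift i = *-cong (𝟙-iff (suc x ≟ suc i) (x ≟ i) FinP.suc-injective (P.cong suc)) refl

  𝟙≢ : ∀ {n} → Fin n → Fin n → Carrier
  𝟙≢ x y = 𝟙 (¬? (x ≟ y))

  𝟙≢-complement : ∀ {n} (x y : Fin n) → 𝟙≢ x y ≈ 1# - 𝟙 (x ≟ y)
  𝟙≢-complement x y with x ≟ y
  ... | yes _ = sym (-‿inverseʳ 1#)
  ... | no _  = sym (trans (+-cong refl -0#≈0#) (+-identityʳ 1#))

  Σ-avoiding : ∀ {n} (p q : Fin n) → p ≢ q → (f : Fin n → Carrier) →
               ΣF n (λ r → (𝟙≢ p r * 𝟙≢ q r) * f r) ≈ (ΣF n f - f p) - f q
  Σ-avoiding {n} p q p≢q f = begin
    ΣF n (λ r → (𝟙≢ p r * 𝟙≢ q r) * f r)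
      ≈⟨ ΣR-cong (allFin n) (λ r → expand r) ⟩
    ΣF n (λ r → (f r - 𝟙 (p ≟ r) * f r) - 𝟙 (q ≟ r) * f r)
      ≈⟨ trans (ΣR-- (allFin n) _ _) (+-cong (ΣR-- (allFin n) _ _) refl) ⟩
    (ΣF n f - ΣF n (λ r → 𝟙 (p ≟ r) * f r)) - ΣF n (λ r → 𝟙 (q ≟ r) * f r)
      ≈⟨ +-cong (+-cong refl (-‿cong (sift p f))) (-‿cong (sift q f)) ⟩
    (ΣF n f - f p) - f q ∎
    where
    open Solver
    expansion : ∀ a b x → ((1# - a) * (1# - b)) * x ≈ (a * b) * x + ((x - a * x) - b * x)
    expansion = solve 3 (λ a b x → ((con (ℤ.+ 1) :- a) :* (con (ℤ.+ 1) :- b)) :* x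
                                  := (a :* b) :* x :+ ((x :- a :* x) :- b :* x)) refl
    expand : ∀ r → (𝟙≢ p r * 𝟙≢ q r) * f r ≈ (f r - 𝟙 (p ≟ r) * f r) - 𝟙 (q ≟ r) * f r
    expand r = begin
      (𝟙≢ p r * 𝟙≢ q r) * f r
        ≈⟨ *-cong (*-cong (𝟙≢-complement p r) (𝟙≢-complement q r)) refl ⟩
      ((1# - 𝟙 (p ≟ r)) * (1# - 𝟙 (q ≟ r))) * f r
        ≈⟨ expansion _ _ _ ⟩
      (𝟙 (p ≟ r) * 𝟙 (q ≟ r)) * f r + ((f r - 𝟙 (p ≟ r) * f r) - 𝟙 (q ≟ r) * f r)
        ≈⟨ +-cong (trans (*-cong (𝟙-disjoint (p ≟ r) (q ≟ r) (λ e e′ → p≢q (P.trans e (P.sym e′)))) refl) (zeroˡ _)) refl ⟩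
      0# + ((f r - 𝟙 (p ≟ r) * f r) - 𝟙 (q ≟ r) * f r)
        ≈⟨ +-identityˡ _ ⟩
      (f r - 𝟙 (p ≟ r) * f r) - 𝟙 (q ≟ r) * f r ∎

  count-below : ∀ {n} (p : Fin n) → ΣF n (λ r → 𝟙 (r <? p)) ≈ natR (toℕ p)
  count-below {suc n} zero = begin
    ΣF (suc n) (λ r → 𝟙 (r <? zero {n}))     ≡⟨ ΣF-suc n _ ⟩
    0# + ΣF n (λ r → 𝟙 (suc r <? zero {n}))  ≈⟨ +-identityˡ _ ⟩
    ΣF n (λ r → 𝟙 (suc r <? zero {n}))       ≈⟨ ΣR-0 (allFin n) (λ r → 𝟙-no (suc r <? zero {n}) (λ ())) ⟩
    0#                                       ∎
  count-below {suc n} (suc p) = begin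
    ΣF (suc n) (λ r → 𝟙 (r <? suc p))                          ≡⟨ ΣF-suc n _ ⟩
    𝟙 (zero {n} <? suc p) + ΣF n (λ r → 𝟙 (suc r <? suc p))    ≈⟨ +-cong (𝟙-yes (zero {n} <? suc p) (s≤s z≤n)) (ΣR-cong (allFin n) shift) ⟩
    1# + ΣF n (λ r → 𝟙 (r <? p))                               ≈⟨ +-cong refl (count-below p) ⟩
    natR (suc (toℕ p))                                         ∎
    where
    shift : ∀ r → 𝟙 (suc r <? suc p) ≈ 𝟙 (r <? p)
    shift r = 𝟙-iff (suc r <? suc p) (r <? p) ℕP.≤-pred s≤s

  trichotomy : ∀ {n} (p r : Fin n) → 𝟙 (r <? p) + (𝟙 (p ≟ r) + 𝟙 (p <? r)) ≈ 1#
  trichotomy p r with ℕP.<-cmp (toℕ r) (toℕ p)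
  ... | tri< r<p _ p≮r = begin
    𝟙 (r <? p) + (𝟙 (p ≟ r) + 𝟙 (p <? r))
      ≈⟨ +-cong (𝟙-yes (r <? p) r<p) (+-cong (𝟙-no (p ≟ r) (λ e → ℕP.<-irrefl (P.cong toℕ (P.sym e)) r<p)) (𝟙-no (p <? r) p≮r)) ⟩
    1# + (0# + 0#)                         ≈⟨ trans (+-cong refl (+-identityˡ 0#)) (+-identityʳ 1#) ⟩
    1#                                     ∎
  ... | tri≈ r≮p r≡p p≮r = begin
    𝟙 (r <? p) + (𝟙 (p ≟ r) + 𝟙 (p <? r))
      ≈⟨ +-cong (𝟙-no (r <? p) r≮p) (+-cong (𝟙-yes (p ≟ r) (FinP.toℕ-injective (P.sym r≡p))) (𝟙-no (p <? r) p≮r)) ⟩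
    0# + (1# + 0#)                         ≈⟨ trans (+-identityˡ _) (+-identityʳ 1#) ⟩
    1#                                     ∎
  ... | tri> r≮p _ p<r = begin
    𝟙 (r <? p) + (𝟙 (p ≟ r) + 𝟙 (p <? r))
      ≈⟨ +-cong (𝟙-no (r <? p) r≮p) (+-cong (𝟙-no (p ≟ r) (λ e → ℕP.<-irrefl (P.cong toℕ e) p<r)) (𝟙-yes (p <? r) p<r)) ⟩
    0# + (0# + 1#)                         ≈⟨ trans (+-identityˡ _) (+-identityˡ 1#) ⟩
    1#                                     ∎

  count-above : ∀ {n} (p : Fin n) → ΣF n (λ r → 𝟙 (p <? r)) ≈ natR n - (1# + natR (toℕ p))
  count-above {n} p = begin
    above                                                                ≈⟨ rearrange above (natR (toℕ p)) ⟩
    (natR (toℕ p) + (1# + above)) - (1# + natR (toℕ p))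
      ≈⟨ +-cong (sym (+-cong (count-below p) (+-cong (sift p (λ _ → 1#)) refl))) refl ⟩
    (ΣF n (λ r → 𝟙 (r <? p)) + (ΣF n (λ r → 𝟙 (p ≟ r) * 1#) + above)) - (1# + natR (toℕ p))
      ≈⟨ +-cong (sym (trans (ΣR-+ (allFin n) _ _) (+-cong refl (ΣR-+ (allFin n) _ _)))) refl ⟩
    ΣF n (λ r → 𝟙 (r <? p) + (𝟙 (p ≟ r) * 1# + 𝟙 (p <? r))) - (1# + natR (toℕ p))
      ≈⟨ +-cong (ΣR-cong (allFin n) (λ r → trans (+-cong refl (+-cong (*-identityʳ _) refl)) (trichotomy p r))) refl ⟩
    ΣF n (λ r → 1#) - (1# + natR (toℕ p))                                ≈⟨ +-cong (trans (ΣF-const n 1#) (*-identityʳ _)) refl ⟩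
    natR n - (1# + natR (toℕ p))                                         ∎
    where
    above = ΣF n (λ r → 𝟙 (p <? r))
    rearrange : ∀ s x → s ≈ (x + (1# + s)) - (1# + x)
    rearrange = solve 2 (λ s x → s := (x :+ (con (ℤ.+ 1) :+ s)) :- (con (ℤ.+ 1) :+ x)) refl
      where open Solver

  ΣΣ : ∀ {n} → (Fin n → Fin n → Carrier) → Carrier
  ΣΣ {n} G = ΣF n (λ i → ΣF n (λ j → G i j))

  module DoubleSums (n : ℕ) where
    ΣΣ-cong : ∀ {G H : Fin n → Fin n → Carrier} → (∀ i j → G i j ≈ H i j) → ΣΣ G ≈ ΣΣ H
    ΣΣ-cong e = ΣR-cong (allFin n) (λ i → ΣR-cong (allFin n) (λ j → e i j))

    ΣΣ-+ : ∀ (G H : Fin n → Fin n → Carrier) → ΣΣ (λ i j → G i j + H i j) ≈ ΣΣ G + ΣΣ H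
    ΣΣ-+ G H = trans (ΣR-cong (allFin n) (λ i → ΣR-+ (allFin n) (G i) (H i))) (ΣR-+ (allFin n) _ _)

    ΣΣ-- : ∀ (G H : Fin n → Fin n → Carrier) → ΣΣ (λ i j → G i j - H i j) ≈ ΣΣ G - ΣΣ H
    ΣΣ-- G H = trans (ΣR-cong (allFin n) (λ i → ΣR-- (allFin n) (G i) (H i))) (ΣR-- (allFin n) _ _)

    ΣΣ-neg : ∀ (G : Fin n → Fin n → Carrier) → ΣΣ (λ i j → - G i j) ≈ - ΣΣ G
    ΣΣ-neg G = trans (ΣR-cong (allFin n) (λ i → ΣR-neg (allFin n) (G i))) (ΣR-neg (allFin n) _)

    ΣΣ-*ˡ : ∀ (k : Carrier) (G : Fin n → Fin n → Carrier) → k * ΣΣ G ≈ ΣΣ (λ i j → k * G i j)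
    ΣΣ-*ˡ k G = trans (ΣR-*ˡ (allFin n) k _) (ΣR-cong (allFin n) (λ i → ΣR-*ˡ (allFin n) k (G i)))

    ΣΣ-*ʳ : ∀ (k : Carrier) (G : Fin n → Fin n → Carrier) → ΣΣ G * k ≈ ΣΣ (λ i j → G i j * k)
    ΣΣ-*ʳ k G = trans (ΣR-*ʳ (allFin n) k _) (ΣR-cong (allFin n) (λ i → ΣR-*ʳ (allFin n) k (G i)))

    sift₂ : ∀ p q (G : Fin n → Fin n → Carrier) → ΣΣ (λ i j → (𝟙 (p ≟ i) * 𝟙 (q ≟ j)) * G i j) ≈ G p q
    sift₂ p q G = begin
      ΣΣ (λ i j → (𝟙 (p ≟ i) * 𝟙 (q ≟ j)) * G i j)
        ≈⟨ ΣR-cong (allFin n) (λ i → trans (ΣR-cong (allFin n) (λ j → *-assoc _ _ _)) (sym (ΣR-*ˡ (allFin n) _ _))) ⟩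
      ΣF n (λ i → 𝟙 (p ≟ i) * ΣF n (λ j → 𝟙 (q ≟ j) * G i j)) ≈⟨ ΣR-cong (allFin n) (λ i → *-cong refl (sift q (G i))) ⟩
      ΣF n (λ i → 𝟙 (p ≟ i) * G i q)                          ≈⟨ sift p (λ i → G i q) ⟩
      G p q                                                    ∎

module PermutationFacts where
  open P.≡-Reasoning

  Perm : ℕ → Set
  Perm = Permutation′

  _≈ₚ?_ : ∀ {n} (σ ρ : Perm n) → Dec (σ ≈ₚ ρ)
  σ ≈ₚ? ρ = all? (λ i → σ ⟨$⟩ʳ i ≟ ρ ⟨$⟩ʳ i)

  ≈ₚ-inverse : ∀ {n} {σ ρ : Perm n} → σ ≈ₚ ρ → ∀ y → σ ⟨$⟩ˡ y ≡ ρ ⟨$⟩ˡ y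
  ≈ₚ-inverse {σ = σ} {ρ} e y =
    P.trans (P.cong (σ ⟨$⟩ˡ_) (P.sym (inverseʳ ρ))) (P.trans (P.cong (σ ⟨$⟩ˡ_) (P.sym (e (ρ ⟨$⟩ˡ y)))) (inverseˡ σ))

  perm-injective : ∀ {n} (σ : Perm n) {x y} → σ ⟨$⟩ʳ x ≡ σ ⟨$⟩ʳ y → x ≡ y
  perm-injective σ e = P.trans (P.sym (inverseˡ σ)) (P.trans (P.cong (σ ⟨$⟩ˡ_) e) (inverseˡ σ))

  -- The permutations σ of Fin (suc n) with σ a = p are exactly the
  -- insert a p ρ, ρ ∈ S_n (ρ = remove a σ).
  insert-at : ∀ {n} (a p : Fin (suc n)) (ρ : Perm n) → insert a p ρ ⟨$⟩ʳ a ≡ p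
  insert-at a p ρ with a ≟ a
  ... | yes _   = P.refl
  ... | no a≢a = ⊥-elim (a≢a P.refl)

  insert-elsewhere : ∀ {n} {a b : Fin (suc n)} (a≢b : a ≢ b) (p : Fin (suc n)) (ρ : Perm n) →
                     insert a p ρ ⟨$⟩ʳ b ≡ punchIn p (ρ ⟨$⟩ʳ punchOut a≢b)
  insert-elsewhere {a = a} a≢b p ρ =
    P.trans (P.cong (insert a p ρ ⟨$⟩ʳ_) (P.sym (FinP.punchIn-punchOut a≢b))) (insert-punchIn a p ρ (punchOut a≢b))

  insert≈⇔remove≈ : ∀ {n} {a p : Fin (suc n)} (σ : Perm (suc n)) (ρ : Perm n) → σ ⟨$⟩ʳ a ≡ p →
                    (insert a p ρ ≈ₚ σ → remove a σ ≈ₚ ρ) × (remove a σ ≈ₚ ρ → insert a p ρ ≈ₚ σ)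
  insert≈⇔remove≈ {a = a} {p} σ ρ σa≡p = to , from
    where
    σ-at-punchIn : ∀ j → σ ⟨$⟩ʳ punchIn a j ≡ punchIn p (remove a σ ⟨$⟩ʳ j)
    σ-at-punchIn j = P.trans (punchIn-permute σ a j) (P.cong (λ x → punchIn x (remove a σ ⟨$⟩ʳ j)) σa≡p)
    to : insert a p ρ ≈ₚ σ → remove a σ ≈ₚ ρ
    to e j = FinP.punchIn-injective p _ _
      (P.sym (P.trans (P.sym (insert-punchIn a p ρ j)) (P.trans (e (punchIn a j)) (σ-at-punchIn j))))
    -- (insert a p ρ) k computes to p when k = a, otherwise to punchIn p (ρ (punchOut a≢k))
    from : remove a σ ≈ₚ ρ → insert a p ρ ≈ₚ σ
    from e k with a ≟ k
    ... | yes P.refl = P.sym σa≡p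
    ... | no a≢k = begin
      punchIn p (ρ ⟨$⟩ʳ punchOut a≢k)            ≡⟨ P.cong (punchIn p) (P.sym (e (punchOut a≢k))) ⟩
      punchIn p (remove a σ ⟨$⟩ʳ punchOut a≢k)   ≡⟨ P.sym (σ-at-punchIn (punchOut a≢k)) ⟩
      σ ⟨$⟩ʳ punchIn a (punchOut a≢k)            ≡⟨ P.cong (σ ⟨$⟩ʳ_) (FinP.punchIn-punchOut a≢k) ⟩
      σ ⟨$⟩ʳ k                                   ∎

module SymmetricSums {c ℓ : Level} (R : CommutativeRing c ℓ) where
  open CommutativeRing R hiding (zero)
  open Poly R
  open RingArithmetic R
  open FiniteSums R
  open PermutationFacts
  open import Relation.Binary.Reasoning.Setoid setoid

  ΣSym : ∀ n → (Perm n → Carrier) → Carrier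
  ΣSym n F = ΣR (Sym n) F

  RespP : ∀ {n} → (Perm n → Carrier) → Set _
  RespP G = ∀ σ ρ → σ ≈ₚ ρ → G σ ≈ G ρ

  RespF : ∀ {m k} → ((Fin m → Fin k) → Carrier) → Set _
  RespF G = ∀ f g → f P.≗ g → G f ≈ G g

  _≗?_ : ∀ {m k} (f g : Fin m → Fin k) → Dec (f P.≗ g)
  f ≗? g = all? (λ i → f i ≟ g i)

  allFuns-suc : ∀ m k (F : (Fin (suc m) → Fin k) → Carrier) → RespF F →
                ΣR (allFuns (suc m) k) F ≈ ΣF k (λ a → ΣR (allFuns m k) (λ f → F (cons a f)))
  allFuns-suc m k F rF = begin
    ΣR (allFuns (suc m) k) F                 ≈⟨ ΣR-concatMap _ (allFin k) F ⟩
    ΣF k (λ a → ΣR (map _ (allFuns m k)) F)  ≈⟨ ΣR-cong (allFin k) (λ a → trans (reflexive (ΣR-map _ (allFuns m k) F))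
                                                  (ΣR-cong (allFuns m k) (λ f → rF _ _ (λ { zero → P.refl ; (suc i) → P.refl })))) ⟩
    ΣF k (λ a → ΣR (allFuns m k) (λ f → F (cons a f))) ∎

  siftFuns : ∀ m k (h : Fin m → Fin k) (G : (Fin m → Fin k) → Carrier) → RespF G →
             ΣR (allFuns m k) (λ f → 𝟙 (h ≗? f) * G f) ≈ G h
  siftFuns zero k h G rG = only-function _
    where
    only-function : (e : Fin 0 → Fin k) → 𝟙 (h ≗? e) * G e + 0# ≈ G h
    only-function e = trans (+-identityʳ _) (trans (*-cong (𝟙-yes (h ≗? e) (λ ())) (rG e h (λ ()))) (*-identityˡ _))
  siftFuns (suc m) k h G rG = begin
    ΣR (allFuns (suc m) k) (λ f → 𝟙 (h ≗? f) * G f)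
      ≈⟨ allFuns-suc m k _ (λ f g e → *-cong (𝟙-iff (h ≗? f) (h ≗? g) (λ q i → P.trans (q i) (e i)) (λ q i → P.trans (q i) (P.sym (e i)))) (rG f g e)) ⟩
    ΣF k (λ a → ΣR (allFuns m k) (λ f → 𝟙 (h ≗? cons a f) * G (cons a f)))
      ≈⟨ ΣR-cong (allFin k) (λ a → ΣR-cong (allFuns m k) (λ f → *-cong (split a f) refl)) ⟩
    ΣF k (λ a → ΣR (allFuns m k) (λ f → (𝟙 (h zero ≟ a) * 𝟙 ((h ∘ suc) ≗? f)) * G (cons a f)))
      ≈⟨ ΣR-cong (allFin k) (λ a → trans (ΣR-cong (allFuns m k) (λ f → *-assoc _ _ _)) (sym (ΣR-*ˡ (allFuns m k) _ _))) ⟩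
    ΣF k (λ a → 𝟙 (h zero ≟ a) * ΣR (allFuns m k) (λ f → 𝟙 ((h ∘ suc) ≗? f) * G (cons a f)))
      ≈⟨ ΣR-cong (allFin k) (λ a → *-cong refl (siftFuns m k (h ∘ suc) (λ f → G (cons a f)) (λ f g e → rG _ _ (λ { zero → P.refl ; (suc i) → e i })))) ⟩
    ΣF k (λ a → 𝟙 (h zero ≟ a) * G (cons a (h ∘ suc)))
      ≈⟨ sift (h zero) (λ a → G (cons a (h ∘ suc))) ⟩
    G (cons (h zero) (h ∘ suc))  ≈⟨ rG _ _ (λ { zero → P.refl ; (suc i) → P.refl }) ⟩
    G h ∎
    where
    split : ∀ a f → 𝟙 (h ≗? cons a f) ≈ 𝟙 (h zero ≟ a) * 𝟙 ((h ∘ suc) ≗? f)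
    split a f = 𝟙-∧ (h ≗? cons a f) (h zero ≟ a) ((h ∘ suc) ≗? f)
                    (λ e → e zero) (λ e i → e (suc i)) (λ { p q zero → p ; p q (suc i) → q i })

  -- sifting over S_n: the enumeration Sym n lists every permutation once
  siftSym : ∀ {n} (ρ : Perm n) (G : Perm n → Carrier) → RespP G → ΣSym n (λ σ → 𝟙 (ρ ≈ₚ? σ) * G σ) ≈ G ρ
  siftSym {n} ρ G rG = begin
    ΣSym n (λ σ → 𝟙 (ρ ≈ₚ? σ) * G σ)
      ≈⟨ trans (ΣR-mapMaybe toPerm (cartesianProduct (allFuns n n) (allFuns n n)) _) (ΣR-cart (allFuns n n) (allFuns n n) _) ⟩
    ΣR (allFuns n n) (λ f → ΣR (allFuns n n) (λ g → maybeR (toPerm (f , g)) (λ σ → 𝟙 (ρ ≈ₚ? σ) * G σ)))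
      ≈⟨ ΣR-cong (allFuns n n) (λ f → trans (ΣR-cong (allFuns n n) (summand f)) (sym (ΣR-*ˡ (allFuns n n) _ _))) ⟩
    ΣR (allFuns n n) (λ f → 𝟙 (ρʳ ≗? f) * ΣR (allFuns n n) (λ g → 𝟙 (ρˡ ≗? g) * G ρ))
      ≈⟨ ΣR-cong (allFuns n n) (λ f → *-cong refl (siftFuns n n ρˡ (λ _ → G ρ) (λ _ _ _ → refl))) ⟩
    ΣR (allFuns n n) (λ f → 𝟙 (ρʳ ≗? f) * G ρ) ≈⟨ siftFuns n n ρʳ (λ _ → G ρ) (λ _ _ _ → refl) ⟩
    G ρ ∎
    where
    ρʳ = ρ ⟨$⟩ʳ_
    ρˡ = ρ ⟨$⟩ˡ_
    inverse-pair : ∀ {f g} → ρʳ P.≗ f → ρˡ P.≗ g → (∀ y → f (g y) ≡ y) × (∀ x → g (f x) ≡ x)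
    inverse-pair {f} {g} p q =
      (λ y → P.trans (P.cong f (P.sym (q y))) (P.trans (P.sym (p (ρˡ y))) (inverseʳ ρ))) ,
      (λ x → P.trans (P.cong g (P.sym (p x))) (P.trans (P.sym (q (ρʳ x))) (inverseˡ ρ)))
    no-pair : ∀ f g → ¬ ((∀ y → f (g y) ≡ y) × (∀ x → g (f x) ≡ x)) → 0# ≈ 𝟙 (ρʳ ≗? f) * (𝟙 (ρˡ ≗? g) * G ρ)
    no-pair f g ¬inv = sym (trans (𝟙-guard (ρʳ ≗? f) (λ p → trans (*-cong (𝟙-no (ρˡ ≗? g) (λ q → ¬inv (inverse-pair p q))) refl) (zeroˡ _))) (zeroʳ _))
    summand : ∀ f g → maybeR (toPerm (f , g)) (λ σ → 𝟙 (ρ ≈ₚ? σ) * G σ) ≈ 𝟙 (ρʳ ≗? f) * (𝟙 (ρˡ ≗? g) * G ρ)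
    summand f g with all? (λ y → f (g y) ≟ y) | all? (λ x → g (f x) ≟ x)
    ... | yes fg | yes gf = is-ρ
      where
      -- (f , g) is the permutation σ, and σ = ρ iff f = ρʳ, in which case g = ρˡ
      σ = permutation f g fg gf
      is-ρ : 𝟙 (ρ ≈ₚ? σ) * G σ ≈ 𝟙 (ρʳ ≗? f) * (𝟙 (ρˡ ≗? g) * G ρ)
      is-ρ = trans (*-cong (𝟙-iff (ρ ≈ₚ? σ) (ρʳ ≗? f) (λ e → e) (λ e → e)) refl)
                       (𝟙-guard (ρʳ ≗? f) (λ p → sym (trans (*-cong (𝟙-yes (ρˡ ≗? g) (inverse-from p)) refl)
                                                             (trans (*-identityˡ _) (rG ρ σ p)))))
        where
        inverse-from : ρʳ P.≗ f → ρˡ P.≗ g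
        inverse-from p y = P.trans (P.sym (gf (ρˡ y))) (P.cong g (P.trans (P.sym (p (ρˡ y))) (inverseʳ ρ)))
    ... | yes fg | no ¬gf = no-pair f g (λ inv → ¬gf (proj₂ inv))
    ... | no ¬fg | _      = no-pair f g (λ inv → ¬fg (proj₁ inv))

  reindex : ∀ {n} (φ ψ : Perm n → Perm n) →
            (∀ σ ρ → φ σ ≈ₚ ρ → ψ ρ ≈ₚ σ) → (∀ σ ρ → ψ ρ ≈ₚ σ → φ σ ≈ₚ ρ) →
            (F : Perm n → Carrier) → RespP F → ΣSym n (λ σ → F (φ σ)) ≈ ΣSym n F
  reindex {n} φ ψ φ⇒ψ ψ⇒φ F rF = begin
    ΣSym n (λ σ → F (φ σ))                                ≈⟨ ΣR-cong (Sym n) (λ σ → sym (siftSym (φ σ) F rF)) ⟩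
    ΣSym n (λ σ → ΣSym n (λ ρ → 𝟙 (φ σ ≈ₚ? ρ) * F ρ))     ≈⟨ ΣR-swap (Sym n) (Sym n) _ ⟩
    ΣSym n (λ ρ → ΣSym n (λ σ → 𝟙 (φ σ ≈ₚ? ρ) * F ρ))     ≈⟨ ΣR-cong (Sym n) (λ ρ → ΣR-cong (Sym n) (λ σ →
                                                              *-cong (𝟙-iff (φ σ ≈ₚ? ρ) (ψ ρ ≈ₚ? σ) (φ⇒ψ σ ρ) (ψ⇒φ σ ρ)) refl)) ⟩
    ΣSym n (λ ρ → ΣSym n (λ σ → 𝟙 (ψ ρ ≈ₚ? σ) * F ρ))     ≈⟨ ΣR-cong (Sym n) (λ ρ → siftSym (ψ ρ) (λ _ → F ρ) (λ _ _ _ → refl)) ⟩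
    ΣSym n F                                              ∎

  pull-right : ∀ {n} (τ : Perm n) (F : Perm n → Carrier) → RespP F → ΣSym n F ≈ ΣSym n (λ σ → F (σ · τ))
  pull-right τ F rF = sym (reindex (λ σ → σ · τ) (λ ρ → ρ · (τ ⁻¹))
    (λ σ ρ e i → P.trans (P.sym (e (τ ⟨$⟩ˡ i))) (P.cong (σ ⟨$⟩ʳ_) (inverseʳ τ)))
    (λ σ ρ e i → P.trans (P.sym (e (τ ⟨$⟩ʳ i))) (P.cong (ρ ⟨$⟩ʳ_) (inverseˡ τ))) F rF)

  fibre : ∀ {n} (a p : Fin (suc n)) (G : Perm (suc n) → Carrier) → RespP G →
          ΣSym (suc n) (λ σ → 𝟙 (σ ⟨$⟩ʳ a ≟ p) * G σ) ≈ ΣSym n (λ ρ → G (insert a p ρ))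
  fibre {n} a p G rG = sym (begin
    ΣSym n (λ ρ → G (insert a p ρ))
      ≈⟨ ΣR-cong (Sym n) (λ ρ → sym (siftSym (insert a p ρ) G rG)) ⟩
    ΣSym n (λ ρ → ΣSym (suc n) (λ σ → 𝟙 (insert a p ρ ≈ₚ? σ) * G σ))
      ≈⟨ ΣR-swap (Sym n) (Sym (suc n)) _ ⟩
    ΣSym (suc n) (λ σ → ΣSym n (λ ρ → 𝟙 (insert a p ρ ≈ₚ? σ) * G σ))
      ≈⟨ ΣR-cong (Sym (suc n)) (λ σ → trans (sym (ΣR-*ʳ (Sym n) _ _)) (*-cong (preimages σ) refl)) ⟩
    ΣSym (suc n) (λ σ → 𝟙 (σ ⟨$⟩ʳ a ≟ p) * G σ) ∎)
    where
    preimages : ∀ σ → ΣSym n (λ ρ → 𝟙 (insert a p ρ ≈ₚ? σ)) ≈ 𝟙 (σ ⟨$⟩ʳ a ≟ p)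
    preimages σ = 𝟙-by (σ ⟨$⟩ʳ a ≟ p)
      (λ σa≡p → begin
        ΣSym n (λ ρ → 𝟙 (insert a p ρ ≈ₚ? σ))
          ≈⟨ ΣR-cong (Sym n) (λ ρ → let (to , from) = insert≈⇔remove≈ σ ρ σa≡p in
                trans (𝟙-iff (insert a p ρ ≈ₚ? σ) (remove a σ ≈ₚ? ρ) to from) (sym (*-identityʳ _))) ⟩
        ΣSym n (λ ρ → 𝟙 (remove a σ ≈ₚ? ρ) * 1#) ≈⟨ siftSym (remove a σ) (λ _ → 1#) (λ _ _ _ → refl) ⟩
        1# ∎)
      (λ σa≢p → ΣR-0 (Sym n) (λ ρ → 𝟙-no (insert a p ρ ≈ₚ? σ) (λ e → σa≢p (P.trans (P.sym (e a)) (insert-at a p ρ)))))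

  insert-value : ∀ {n} {a b p q : Fin (suc n)} (a≢b : a ≢ b) (p≢q : p ≢ q) (ρ : Perm n) →
                 𝟙 (insert a p ρ ⟨$⟩ʳ b ≟ q) ≈ 𝟙 (ρ ⟨$⟩ʳ punchOut a≢b ≟ punchOut p≢q)
  insert-value {a = a} {b} {p} {q} a≢b p≢q ρ =
    𝟙-iff (insert a p ρ ⟨$⟩ʳ b ≟ q) (ρ ⟨$⟩ʳ punchOut a≢b ≟ punchOut p≢q)
      (λ e → FinP.punchIn-injective p _ _ (P.trans (P.sym at-b) (P.trans e (P.sym (FinP.punchIn-punchOut p≢q)))))
      (λ e → P.trans at-b (P.trans (P.cong (punchIn p) e) (FinP.punchIn-punchOut p≢q)))
    where at-b = insert-elsewhere a≢b p ρ

  resp-value : ∀ {n} (a p : Fin n) → RespP (λ σ → 𝟙 (σ ⟨$⟩ʳ a ≟ p))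
  resp-value a p σ ρ e = 𝟙-iff (σ ⟨$⟩ʳ a ≟ p) (ρ ⟨$⟩ʳ a ≟ p) (P.trans (P.sym (e a))) (P.trans (e a))

  card : ∀ n → ΣSym n (λ _ → 1#) ≈ natR (n !)
  card zero    = refl
  card (suc n) = begin
    ΣSym (suc n) (λ _ → 1#)
      ≈⟨ ΣR-cong (Sym (suc n)) (λ σ → sym (trans (ΣR-cong (allFin (suc n)) (λ p → sym (*-identityʳ _))) (sift (σ ⟨$⟩ʳ zero) (λ _ → 1#)))) ⟩
    ΣSym (suc n) (λ σ → ΣF (suc n) (λ p → 𝟙 (σ ⟨$⟩ʳ zero ≟ p)))
      ≈⟨ ΣR-swap (Sym (suc n)) (allFin (suc n)) _ ⟩
    ΣF (suc n) (λ p → ΣSym (suc n) (λ σ → 𝟙 (σ ⟨$⟩ʳ zero ≟ p)))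
      ≈⟨ ΣR-cong (allFin (suc n)) (λ p → trans (ΣR-cong (Sym (suc n)) (λ σ → sym (*-identityʳ _)))
                                          (trans (fibre zero p (λ _ → 1#) (λ _ _ _ → refl)) (card n))) ⟩
    ΣF (suc n) (λ p → natR (n !)) ≈⟨ ΣF-const (suc n) _ ⟩
    natR (suc n) * natR (n !)     ≈⟨ sym (natR-* (suc n) (n !)) ⟩
    natR (suc n ℕ.* n !)          ∎

  count₂ : ∀ {m} {a b p q : Fin (2 ℕ.+ m)} → a ≢ b → p ≢ q →
           ΣSym (2 ℕ.+ m) (λ σ → 𝟙 (σ ⟨$⟩ʳ a ≟ p) * 𝟙 (σ ⟨$⟩ʳ b ≟ q)) ≈ natR (m !)
  count₂ {m} {a} {b} {p} {q} a≢b p≢q = begin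
    ΣSym (2 ℕ.+ m) (λ σ → 𝟙 (σ ⟨$⟩ʳ a ≟ p) * 𝟙 (σ ⟨$⟩ʳ b ≟ q))
      ≈⟨ fibre a p _ (resp-value b q) ⟩
    ΣSym (suc m) (λ ρ → 𝟙 (insert a p ρ ⟨$⟩ʳ b ≟ q))
      ≈⟨ ΣR-cong (Sym (suc m)) (λ ρ → trans (insert-value a≢b p≢q ρ) (sym (*-identityʳ _))) ⟩
    ΣSym (suc m) (λ ρ → 𝟙 (ρ ⟨$⟩ʳ punchOut a≢b ≟ punchOut p≢q) * 1#)
      ≈⟨ fibre (punchOut a≢b) (punchOut p≢q) (λ _ → 1#) (λ _ _ _ → refl) ⟩
    ΣSym m (λ _ → 1#) ≈⟨ card m ⟩
    natR (m !) ∎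

  count₃ : ∀ {m} {a b c p q r : Fin (3 ℕ.+ m)} → a ≢ b → a ≢ c → b ≢ c → p ≢ q → p ≢ r → q ≢ r →
           ΣSym (3 ℕ.+ m) (λ σ → 𝟙 (σ ⟨$⟩ʳ a ≟ p) * (𝟙 (σ ⟨$⟩ʳ b ≟ q) * 𝟙 (σ ⟨$⟩ʳ c ≟ r))) ≈ natR (m !)
  count₃ {m} {a} {b} {c} {p} {q} {r} a≢b a≢c b≢c p≢q p≢r q≢r = begin
    ΣSym (3 ℕ.+ m) (λ σ → 𝟙 (σ ⟨$⟩ʳ a ≟ p) * (𝟙 (σ ⟨$⟩ʳ b ≟ q) * 𝟙 (σ ⟨$⟩ʳ c ≟ r)))
      ≈⟨ fibre a p _ (λ σ ρ e → *-cong (resp-value b q σ ρ e) (resp-value c r σ ρ e)) ⟩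
    ΣSym (2 ℕ.+ m) (λ ρ → 𝟙 (insert a p ρ ⟨$⟩ʳ b ≟ q) * 𝟙 (insert a p ρ ⟨$⟩ʳ c ≟ r))
      ≈⟨ ΣR-cong (Sym (2 ℕ.+ m)) (λ ρ → *-cong (insert-value a≢b p≢q ρ) (insert-value a≢c p≢r ρ)) ⟩
    ΣSym (2 ℕ.+ m) (λ ρ → 𝟙 (ρ ⟨$⟩ʳ punchOut a≢b ≟ punchOut p≢q) * 𝟙 (ρ ⟨$⟩ʳ punchOut a≢c ≟ punchOut p≢r))
      ≈⟨ count₂ (b≢c ∘ FinP.punchOut-injective a≢b a≢c) (q≢r ∘ FinP.punchOut-injective p≢q p≢r) ⟩
    natR (m !) ∎

  ΣSym-ΣΣ : ∀ {n N} (F : Perm N → Fin n → Fin n → Carrier) →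
            ΣSym N (λ σ → ΣΣ (F σ)) ≈ ΣΣ (λ p q → ΣSym N (λ σ → F σ p q))
  ΣSym-ΣΣ {n} {N} F =
    trans (ΣR-swap (Sym N) (allFin n) _) (ΣR-cong (allFin n) (λ p → ΣR-swap (Sym N) (allFin n) _))

  -- Sums of a function of the values of σ at two (three) distinct points:
  -- each pair (triple) of distinct values is taken by (n-2)! ((n-3)!)
  -- permutations.
  sum-of-two-values : ∀ {m} {a b : Fin (2 ℕ.+ m)} → a ≢ b → (H : Fin (2 ℕ.+ m) → Fin (2 ℕ.+ m) → Carrier) →
                      (∀ p → H p p ≈ 0#) → ΣSym (2 ℕ.+ m) (λ σ → H (σ ⟨$⟩ʳ a) (σ ⟨$⟩ʳ b)) ≈ natR (m !) * ΣΣ H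
  sum-of-two-values {m} {a} {b} a≢b H H-diagonal = begin
    ΣSym n (λ σ → H (σ ⟨$⟩ʳ a) (σ ⟨$⟩ʳ b))
      ≈⟨ ΣR-cong (Sym n) (λ σ → sym (sift₂ (σ ⟨$⟩ʳ a) (σ ⟨$⟩ʳ b) H)) ⟩
    ΣSym n (λ σ → ΣΣ (λ p q → (𝟙 (σ ⟨$⟩ʳ a ≟ p) * 𝟙 (σ ⟨$⟩ʳ b ≟ q)) * H p q))
      ≈⟨ ΣSym-ΣΣ {n} {n} _ ⟩
    ΣΣ (λ p q → ΣSym n (λ σ → (𝟙 (σ ⟨$⟩ʳ a ≟ p) * 𝟙 (σ ⟨$⟩ʳ b ≟ q)) * H p q))
      ≈⟨ ΣΣ-cong (λ p q → trans (sym (ΣR-*ʳ (Sym n) _ _)) (term p q)) ⟩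
    ΣΣ (λ p q → natR (m !) * H p q) ≈⟨ sym (ΣΣ-*ˡ (natR (m !)) H) ⟩
    natR (m !) * ΣΣ H ∎
    where
    n = 2 ℕ.+ m
    open DoubleSums n
    term : ∀ p q → ΣSym n (λ σ → 𝟙 (σ ⟨$⟩ʳ a ≟ p) * 𝟙 (σ ⟨$⟩ʳ b ≟ q)) * H p q ≈ natR (m !) * H p q
    term p q with p ≟ q
    ... | no p≢q     = *-cong (count₂ a≢b p≢q) refl
    ... | yes P.refl = trans (*-cong refl (H-diagonal p)) (trans (zeroʳ _) (sym (trans (*-cong refl (H-diagonal p)) (zeroʳ _))))

  distinct₃ : ∀ {n} → Fin n → Fin n → Fin n → Carrier
  distinct₃ p q r = 𝟙≢ p q * (𝟙≢ p r * 𝟙≢ q r)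

  both-zero : ∀ {N} {F : Perm N → Carrier} {k d} → (∀ σ → F σ ≈ 0#) → d ≈ 0# → ΣSym N F ≈ k * d
  both-zero {N} F≈0 d≈0 = trans (ΣR-0 (Sym N) F≈0) (sym (trans (*-cong refl d≈0) (zeroʳ _)))

  count₃′ : ∀ {m} {a b c : Fin (3 ℕ.+ m)} → a ≢ b → a ≢ c → b ≢ c → ∀ p q r →
            ΣSym (3 ℕ.+ m) (λ σ → 𝟙 (σ ⟨$⟩ʳ a ≟ p) * (𝟙 (σ ⟨$⟩ʳ b ≟ q) * 𝟙 (σ ⟨$⟩ʳ c ≟ r))) ≈ natR (m !) * distinct₃ p q r
  count₃′ {m} {a} {b} {c} a≢b a≢c b≢c p q r = cases p q r (p ≟ q) (p ≟ r) (q ≟ r)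
    where
    N = 3 ℕ.+ m
    collide : ∀ {x y} → x ≢ y → ∀ (σ : Perm N) p → 𝟙 (σ ⟨$⟩ʳ x ≟ p) * 𝟙 (σ ⟨$⟩ʳ y ≟ p) ≈ 0#
    collide x≢y σ p = 𝟙-disjoint (σ ⟨$⟩ʳ _ ≟ p) (σ ⟨$⟩ʳ _ ≟ p) (λ e e′ → x≢y (perm-injective σ (P.trans e (P.sym e′))))
    𝟙≢-refl : ∀ (p : Fin N) → 𝟙≢ p p ≈ 0#
    𝟙≢-refl p = 𝟙-no (¬? (p ≟ p)) (λ f → f P.refl)
    cases : ∀ p q r → Dec (p ≡ q) → Dec (p ≡ r) → Dec (q ≡ r) →
            ΣSym N (λ σ → 𝟙 (σ ⟨$⟩ʳ a ≟ p) * (𝟙 (σ ⟨$⟩ʳ b ≟ q) * 𝟙 (σ ⟨$⟩ʳ c ≟ r))) ≈ natR (m !) * distinct₃ p q r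
    cases p q r (no p≢q) (no p≢r) (no q≢r) = trans (count₃ a≢b a≢c b≢c p≢q p≢r q≢r) (sym (trans (*-cong refl all-one) (*-identityʳ _)))
      where
      all-one : distinct₃ p q r ≈ 1#
      all-one = trans (*-cong (𝟙-yes (¬? (p ≟ q)) p≢q) (*-cong (𝟙-yes (¬? (p ≟ r)) p≢r) (𝟙-yes (¬? (q ≟ r)) q≢r)))
                      (trans (*-identityˡ _) (*-identityˡ 1#))
    cases p .p r (yes P.refl) _ _ = both-zero
      (λ σ → trans (sym (*-assoc _ _ _)) (trans (*-cong (collide a≢b σ p) refl) (zeroˡ _)))
      (trans (*-cong (𝟙≢-refl p) refl) (zeroˡ _))
    cases p q .p (no _) (yes P.refl) _ = both-zero
      (λ σ → trans (*-cong refl (*-comm _ _)) (trans (sym (*-assoc _ _ _)) (trans (*-cong (collide a≢c σ p) refl) (zeroˡ _))))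
      (trans (*-cong refl (trans (*-cong (𝟙≢-refl p) refl) (zeroˡ _))) (zeroʳ _))
    cases p q .q (no _) (no _) (yes P.refl) = both-zero
      (λ σ → trans (*-cong refl (collide b≢c σ q)) (zeroʳ _))
      (trans (*-cong refl (trans (*-cong refl (𝟙≢-refl q)) (zeroʳ _))) (zeroʳ _))

  sum-of-three-values : ∀ {m} {a b c : Fin (3 ℕ.+ m)} → a ≢ b → a ≢ c → b ≢ c →
    (H : Fin (3 ℕ.+ m) → Fin (3 ℕ.+ m) → Fin (3 ℕ.+ m) → Carrier) →
    ΣSym (3 ℕ.+ m) (λ σ → H (σ ⟨$⟩ʳ a) (σ ⟨$⟩ʳ b) (σ ⟨$⟩ʳ c)) ≈
    natR (m !) * ΣΣ (λ p q → ΣF (3 ℕ.+ m) (λ r → distinct₃ p q r * H p q r))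
  sum-of-three-values {m} {a} {b} {c} a≢b a≢c b≢c H = begin
    ΣSym N (λ σ → H (σ ⟨$⟩ʳ a) (σ ⟨$⟩ʳ b) (σ ⟨$⟩ʳ c))
      ≈⟨ ΣR-cong (Sym N) expand ⟩
    ΣSym N (λ σ → ΣΣ (λ p q → ΣF N (λ r → I σ p q r * H p q r)))
      ≈⟨ ΣSym-ΣΣ {N} {N} _ ⟩
    ΣΣ (λ p q → ΣSym N (λ σ → ΣF N (λ r → I σ p q r * H p q r)))
      ≈⟨ ΣΣ-cong (λ p q → ΣR-swap (Sym N) (allFin N) _) ⟩
    ΣΣ (λ p q → ΣF N (λ r → ΣSym N (λ σ → I σ p q r * H p q r)))
      ≈⟨ ΣΣ-cong (λ p q → ΣR-cong (allFin N) (λ r → trans (sym (ΣR-*ʳ (Sym N) _ _))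
                                                          (trans (*-cong (count₃′ a≢b a≢c b≢c p q r) refl) (*-assoc _ _ _)))) ⟩
    ΣΣ (λ p q → ΣF N (λ r → natR (m !) * (distinct₃ p q r * H p q r)))
      ≈⟨ ΣΣ-cong (λ p q → sym (ΣR-*ˡ (allFin N) _ _)) ⟩
    ΣΣ (λ p q → natR (m !) * ΣF N (λ r → distinct₃ p q r * H p q r))
      ≈⟨ sym (ΣΣ-*ˡ (natR (m !)) _) ⟩
    natR (m !) * ΣΣ (λ p q → ΣF N (λ r → distinct₃ p q r * H p q r)) ∎
    where
    N = 3 ℕ.+ m
    open DoubleSums N
    I : Perm N → Fin N → Fin N → Fin N → Carrier
    I σ p q r = 𝟙 (σ ⟨$⟩ʳ a ≟ p) * (𝟙 (σ ⟨$⟩ʳ b ≟ q) * 𝟙 (σ ⟨$⟩ʳ c ≟ r))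
    regroup : ∀ x y z w → (x * y) * (z * w) ≈ (x * (y * z)) * w
    regroup = solve 4 (λ x y z w → (x :* y) :* (z :* w) := (x :* (y :* z)) :* w) refl
      where open Solver
    expand : ∀ σ → H (σ ⟨$⟩ʳ a) (σ ⟨$⟩ʳ b) (σ ⟨$⟩ʳ c) ≈ ΣΣ (λ p q → ΣF N (λ r → I σ p q r * H p q r))
    expand σ = begin
      H (σ ⟨$⟩ʳ a) (σ ⟨$⟩ʳ b) (σ ⟨$⟩ʳ c)
        ≈⟨ sym (sift₂ (σ ⟨$⟩ʳ a) (σ ⟨$⟩ʳ b) (λ p q → H p q (σ ⟨$⟩ʳ c))) ⟩
      ΣΣ (λ p q → (𝟙 (σ ⟨$⟩ʳ a ≟ p) * 𝟙 (σ ⟨$⟩ʳ b ≟ q)) * H p q (σ ⟨$⟩ʳ c))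
        ≈⟨ ΣΣ-cong (λ p q → *-cong refl (sym (sift (σ ⟨$⟩ʳ c) (H p q)))) ⟩
      ΣΣ (λ p q → (𝟙 (σ ⟨$⟩ʳ a ≟ p) * 𝟙 (σ ⟨$⟩ʳ b ≟ q)) * ΣF N (λ r → 𝟙 (σ ⟨$⟩ʳ c ≟ r) * H p q r))
        ≈⟨ ΣΣ-cong (λ p q → trans (ΣR-*ˡ (allFin N) _ _) (ΣR-cong (allFin N) (λ r → regroup _ _ _ _))) ⟩
      ΣΣ (λ p q → ΣF N (λ r → I σ p q r * H p q r)) ∎

module Progressions {c ℓ : Level} (R : CommutativeRing c ℓ) {n : ℕ} where
  open CommutativeRing R hiding (zero)
  open Poly R
  open import Relation.Binary.Reasoning.Setoid setoid

  progression : (φ : Fin n → Carrier) (k : Carrier) (a b : Fin n) → toℕ a ≤ toℕ b →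
    (∀ v v′ → toℕ v′ ≡ suc (toℕ v) → toℕ a ≤ toℕ v → toℕ v′ ≤ toℕ b → φ v′ ≈ φ v + k) →
    φ b ≈ φ a + natR (toℕ b ∸ toℕ a) * k
  progression φ k a b a≤b step =
    trans (reflexive (P.cong φ (P.sym (FinP.fromℕ<-toℕ b (FinP.toℕ<n b))))) (up-to (toℕ b) (FinP.toℕ<n b) a≤b ℕP.≤-refl)
    where
    up-to : ∀ j (j<n : j ℕ.< n) → toℕ a ≤ j → j ≤ toℕ b → φ (fromℕ< j<n) ≈ φ a + natR (j ∸ toℕ a) * k
    up-to j j<n a≤j j≤b with ℕP.m≤n⇒m<n∨m≡n a≤j
    ... | inj₂ P.refl = begin
      φ (fromℕ< j<n)                 ≡⟨ P.cong φ (FinP.toℕ-injective (FinP.toℕ-fromℕ< j<n)) ⟩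
      φ a
        ≈⟨ sym (trans (+-cong refl (trans (*-cong (reflexive (P.cong natR (ℕP.n∸n≡0 j))) refl) (zeroˡ k))) (+-identityʳ _)) ⟩
      φ a + natR (j ∸ j) * k         ∎
    up-to (suc j) j+1<n a≤j+1 j+1≤b | inj₁ a<j+1 = begin
      φ (fromℕ< j+1<n)                  ≈⟨ step (fromℕ< j<n) (fromℕ< j+1<n)
                                             (P.trans (FinP.toℕ-fromℕ< j+1<n) (P.cong suc (P.sym (FinP.toℕ-fromℕ< j<n))))
                                             (P.subst (toℕ a ≤_) (P.sym (FinP.toℕ-fromℕ< j<n)) a≤j)
                                             (P.subst (_≤ toℕ b) (P.sym (FinP.toℕ-fromℕ< j+1<n)) j+1≤b) ⟩
      φ (fromℕ< j<n) + k                ≈⟨ +-cong (up-to j j<n a≤j (ℕP.<⇒≤ j+1≤b)) refl ⟩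
      (φ a + natR (j ∸ toℕ a) * k) + k
        ≈⟨ trans (+-assoc _ _ _) (+-cong refl (trans (+-comm _ _) (sym (trans (distribʳ _ _ _) (+-cong (*-identityˡ k) refl))))) ⟩
      φ a + natR (suc (j ∸ toℕ a)) * k  ≡⟨ P.cong (λ d → φ a + natR d * k) (P.sym (ℕP.+-∸-assoc 1 a≤j)) ⟩
      φ a + natR (suc j ∸ toℕ a) * k    ∎
      where
      a≤j : toℕ a ≤ j
      a≤j = ℕP.m<1+n⇒m≤n a<j+1
      j<n : j ℕ.< n
      j<n = ℕP.<-trans (ℕP.n<1+n j) j+1<n

  constant-between : (φ : Fin n → Carrier) (a b : Fin n) → toℕ a ≤ toℕ b →
    (∀ v v′ → toℕ v′ ≡ suc (toℕ v) → toℕ a ≤ toℕ v → toℕ v′ ≤ toℕ b → φ v′ ≈ φ v) → φ b ≈ φ a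
  constant-between φ a b a≤b step =
    trans (progression φ 0# a b a≤b (λ v v′ adj l h → trans (step v v′ adj l h) (sym (+-identityʳ _))))
          (trans (+-cong refl (zeroʳ _)) (+-identityʳ _))

module Inversions {c ℓ : Level} (R : CommutativeRing c ℓ) {n : ℕ} (X : Fin n → Fin n → CommutativeRing.Carrier R) where
  open CommutativeRing R hiding (zero)
  open Poly R
  open RingArithmetic R
  open FiniteSums R
  open PermutationFacts
  open SymmetricSums R
  open DoubleSums n
  open import Relation.Binary.Reasoning.Setoid setoid

  W : Fin n → Fin n → Carrier
  W i j = 𝟙 (i <? j) * X i j

  signedW : Fin n → Fin n → Carrier
  signedW p q = W p q - W q p

  signedW-diagonal : ∀ p → signedW p p ≈ 0#
  signedW-diagonal p = -‿inverseʳ _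

  Σpairs-as-ΣΣ : (G : Fin n → Fin n → Carrier) → Σpairs G ≈ ΣΣ (λ i j → 𝟙 (i <? j) * G i j)
  Σpairs-as-ΣΣ G = trans (ΣR-cart (allFin n) (allFin n) _) (ΣΣ-cong (λ i j → if-as-𝟙 (i <? j) (G i j)))

  Σpairs-weighted : (k : Fin n → Fin n → Carrier) → Σpairs (λ i j → k i j * X i j) ≈ ΣΣ (λ i j → W i j * k i j)
  Σpairs-weighted k = trans (Σpairs-as-ΣΣ _) (ΣΣ-cong (λ i j → trans (*-cong refl (*-comm _ _)) (sym (*-assoc _ _ _))))

  inv-as-ΣΣ : (ρ : Perm n) → invX X ρ ≈ ΣΣ (λ i j → W i j * 𝟙 (ρ ⟨$⟩ʳ j <? ρ ⟨$⟩ʳ i))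
  inv-as-ΣΣ ρ = trans (Σpairs-as-ΣΣ _) (ΣΣ-cong (λ i j → trans (*-cong refl (if-as-𝟙 (ρ ⟨$⟩ʳ j <? ρ ⟨$⟩ʳ i) (X i j)))
                  (trans (*-cong refl (*-comm _ _)) (sym (*-assoc _ _ _)))))

  W-guard : ∀ p q {x y} → (toℕ p ℕ.< toℕ q → x ≈ y) → W p q * x ≈ W p q * y
  W-guard p q f = trans (*-assoc _ _ _) (trans (𝟙-guard (p <? q) (λ h → *-cong refl (f h))) (sym (*-assoc _ _ _)))

  signedW-sum : ∀ (F : Fin n → Fin n → Carrier) → ΣΣ (λ p q → signedW p q * F p q) ≈ ΣΣ (λ p q → W p q * (F p q - F q p))
  signedW-sum F = begin
    ΣΣ (λ p q → signedW p q * F p q)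
      ≈⟨ ΣΣ-cong (λ p q → solve 3 (λ a b f → (a :- b) :* f := a :* f :- b :* f) refl _ _ _) ⟩
    ΣΣ (λ p q → W p q * F p q - W q p * F p q)              ≈⟨ ΣΣ-- _ _ ⟩
    ΣΣ (λ p q → W p q * F p q) - ΣΣ (λ p q → W q p * F p q) ≈⟨ +-cong refl (-‿cong (ΣR-swap (allFin n) (allFin n) _)) ⟩
    ΣΣ (λ p q → W p q * F p q) - ΣΣ (λ p q → W p q * F q p) ≈⟨ sym (ΣΣ-- _ _) ⟩
    ΣΣ (λ p q → W p q * F p q - W p q * F q p)
      ≈⟨ ΣΣ-cong (λ p q → solve 3 (λ w a b → w :* a :- w :* b := w :* (a :- b)) refl _ _ _) ⟩
    ΣΣ (λ p q → W p q * (F p q - F q p))                    ∎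
    where open Solver

  invX-resp : RespP (invX X)
  invX-resp ρ ρ′ e = trans (inv-as-ΣΣ ρ) (trans (ΣΣ-cong (λ i j → *-cong refl (𝟙-iff (ρ ⟨$⟩ʳ j <? ρ ⟨$⟩ʳ i) (ρ′ ⟨$⟩ʳ j <? ρ′ ⟨$⟩ʳ i)
      (P.subst₂ (λ a b → toℕ a ℕ.< toℕ b) (e j) (e i)) (P.subst₂ (λ a b → toℕ a ℕ.< toℕ b) (P.sym (e j)) (P.sym (e i))))))
    (sym (inv-as-ΣΣ ρ′)))

  invX⁻¹-resp : RespP (λ σ → invX X (σ ⁻¹))
  invX⁻¹-resp σ ρ e = invX-resp (σ ⁻¹) (ρ ⁻¹) (≈ₚ-inverse {σ = σ} {ρ} e)

  T : (Fin n → Fin n → Carrier) → Fin n → Fin n → Carrier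
  T H a b = ΣSym n (λ σ → invX X (σ ⁻¹) * H (σ ⟨$⟩ʳ a) (σ ⟨$⟩ʳ b))

  resp-values : ∀ (H : Fin n → Fin n → Carrier) (a b : Fin n) → RespP (λ σ → H (σ ⟨$⟩ʳ a) (σ ⟨$⟩ʳ b))
  resp-values H a b σ ρ e = reflexive (P.cong₂ H (e a) (e b))

  module Adjacent (v v′ : Fin n) (adjacent : toℕ v′ ≡ suc (toℕ v)) where
    v<v′ : toℕ v ℕ.< toℕ v′
    v<v′ = P.subst (toℕ v ℕ.<_) (P.sym adjacent) (ℕP.n<1+n _)

    v≢v′ : v ≢ v′
    v≢v′ e = ℕP.<-irrefl (P.cong toℕ e) v<v′

    t : Perm n
    t = transpose v v′

    t-v : t ⟨$⟩ʳ v ≡ v′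
    t-v rewrite dec-true (v ≟ v) P.refl = P.refl

    t-v′ : t ⟨$⟩ʳ v′ ≡ v
    t-v′ with v′ ≟ v
    ... | yes e = e
    ... | no _  rewrite dec-true (v′ ≟ v′) P.refl = P.refl

    t-fixes : ∀ z → z ≢ v → z ≢ v′ → t ⟨$⟩ʳ z ≡ z
    t-fixes z z≢v z≢v′ rewrite dec-false (z ≟ v) z≢v | dec-false (z ≟ v′) z≢v′ = P.refl

    -- τ is the function of t⁻¹ (= t): it swaps v and v′ and fixes the rest
    τ : Fin n → Fin n
    τ = t ⟨$⟩ˡ_

    τ-v : τ v ≡ v′
    τ-v = P.trans (P.cong τ (P.sym t-v′)) (inverseˡ t)

    τ-v′ : τ v′ ≡ v
    τ-v′ = P.trans (P.cong τ (P.sym t-v)) (inverseˡ t)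

    τ-fixes : ∀ z → z ≢ v → z ≢ v′ → τ z ≡ z
    τ-fixes z z≢v z≢v′ = P.trans (P.cong τ (P.sym (t-fixes z z≢v z≢v′))) (inverseˡ t)

    private
      _<ᶠ_ : Fin n → Fin n → Set
      a <ᶠ b = toℕ a ℕ.< toℕ b

      ≢ᶠ : ∀ {a b : Fin n} → a ≢ b → toℕ a ≢ toℕ b
      ≢ᶠ a≢b e = a≢b (FinP.toℕ-injective e)

    preserves-order : ∀ x y → ¬ (x ≡ v × y ≡ v′) → ¬ (x ≡ v′ × y ≡ v) → y <ᶠ x → τ y <ᶠ τ x
    preserves-order x y = cases x y (x ≟ v) (x ≟ v′) (y ≟ v) (y ≟ v′)
      where
      cases : ∀ x y → Dec (x ≡ v) → Dec (x ≡ v′) → Dec (y ≡ v) → Dec (y ≡ v′) →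
              ¬ (x ≡ v × y ≡ v′) → ¬ (x ≡ v′ × y ≡ v) → y <ᶠ x → τ y <ᶠ τ x
      -- x = v: then y < v < v′ and y is fixed
      cases x y (yes P.refl) _ _ _ n₁ n₂ y<x =
        P.subst₂ _<ᶠ_ (P.sym (τ-fixes y (λ e → ℕP.<-irrefl (P.cong toℕ e) y<x) (λ e → ℕP.<-asym (P.subst (_<ᶠ x) e y<x) v<v′)))
          (P.sym τ-v) (ℕP.<-trans y<x v<v′)
      -- x = v′: then y < v′ and y ≢ v give y < v, and y is fixed
      cases x y (no _) (yes P.refl) _ _ n₁ n₂ y<x =
        P.subst₂ _<ᶠ_ (P.sym (τ-fixes y y≢v (λ e → ℕP.<-irrefl (P.cong toℕ e) y<x))) (P.sym τ-v′)
          (ℕP.≤∧≢⇒< (ℕP.m<1+n⇒m≤n (P.subst (toℕ y ℕ.<_) adjacent y<x)) (≢ᶠ y≢v))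
        where
        y≢v : y ≢ v
        y≢v e = n₂ (P.refl , e)
      -- x is fixed, y = v: v < x and x ≢ v′ give v′ < x
      cases x y (no x≢v) (no x≢v′) (yes P.refl) _ n₁ n₂ y<x =
        P.subst₂ _<ᶠ_ (P.sym τ-v) (P.sym (τ-fixes x x≢v x≢v′))
          (ℕP.≤∧≢⇒< (P.subst (ℕ._≤ toℕ x) (P.sym adjacent) y<x) (λ e → ≢ᶠ x≢v′ (P.sym e)))
      -- x is fixed, y = v′: v < v′ < x
      cases x y (no x≢v) (no x≢v′) (no _) (yes P.refl) n₁ n₂ y<x =
        P.subst₂ _<ᶠ_ (P.sym τ-v′) (P.sym (τ-fixes x x≢v x≢v′)) (ℕP.<-trans v<v′ y<x)
      cases x y (no x≢v) (no x≢v′) (no y≢v) (no y≢v′) n₁ n₂ y<x =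
        P.subst₂ _<ᶠ_ (P.sym (τ-fixes y y≢v y≢v′)) (P.sym (τ-fixes x x≢v x≢v′)) y<x

    reflects-order : ∀ x y → ¬ (x ≡ v × y ≡ v′) → ¬ (x ≡ v′ × y ≡ v) → τ y <ᶠ τ x → y <ᶠ x
    reflects-order x y n₁ n₂ τy<τx with ℕP.<-cmp (toℕ y) (toℕ x)
    ... | tri< y<x _ _ = y<x
    ... | tri≈ _ y≡x _ = ⊥-elim (ℕP.<-irrefl (P.cong (toℕ ∘ τ) (FinP.toℕ-injective y≡x)) τy<τx)
    ... | tri> _ _ x<y = ⊥-elim (ℕP.<-asym τy<τx
                                  (preserves-order y x (λ (a , b) → n₂ (b , a)) (λ (a , b) → n₁ (b , a)) x<y))

    order-change : ∀ x y →
      𝟙 (τ y <? τ x) ≈ 𝟙 (y <? x) + (𝟙 (x ≟ v) * 𝟙 (y ≟ v′) - 𝟙 (x ≟ v′) * 𝟙 (y ≟ v))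
    order-change x y = cases x y (x ≟ v) (y ≟ v′) (x ≟ v′) (y ≟ v)
      where
      open Solver
      Goal : ∀ x y → Dec (x ≡ v) → Dec (y ≡ v′) → Dec (x ≡ v′) → Dec (y ≡ v) → Set _
      Goal x y d₁ d₂ d₃ d₄ = 𝟙 (τ y <? τ x) ≈ 𝟙 (y <? x) + (𝟙 d₁ * 𝟙 d₂ - 𝟙 d₃ * 𝟙 d₄)
      apart : ∀ x y d₁ d₂ d₃ d₄ → ¬ (x ≡ v × y ≡ v′) → ¬ (x ≡ v′ × y ≡ v) → Goal x y d₁ d₂ d₃ d₄
      apart x y d₁ d₂ d₃ d₄ n₁ n₂ = begin
        𝟙 (τ y <? τ x)
          ≈⟨ 𝟙-iff (τ y <? τ x) (y <? x) (reflects-order x y n₁ n₂) (preserves-order x y n₁ n₂) ⟩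
        𝟙 (y <? x)                                       ≈⟨ solve 1 (λ a → a := a :+ (con (ℤ.+ 0) :- con (ℤ.+ 0))) refl _ ⟩
        𝟙 (y <? x) + (0# - 0#)
          ≈⟨ +-cong refl (sym (+-cong (𝟙-disjoint d₁ d₂ (λ a b → n₁ (a , b))) (-‿cong (𝟙-disjoint d₃ d₄ (λ a b → n₂ (a , b)))))) ⟩
        𝟙 (y <? x) + (𝟙 d₁ * 𝟙 d₂ - 𝟙 d₃ * 𝟙 d₄)        ∎
      cases : ∀ x y d₁ d₂ d₃ d₄ → Goal x y d₁ d₂ d₃ d₄
      cases x y (yes P.refl) (yes P.refl) d₃ d₄ = begin
        𝟙 (τ v′ <? τ v)                          ≈⟨ 𝟙-yes (τ v′ <? τ v) (P.subst₂ _<ᶠ_ (P.sym τ-v′) (P.sym τ-v) v<v′) ⟩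
        1#
          ≈⟨ solve 1 (λ a → con (ℤ.+ 1) := con (ℤ.+ 0) :+ (con (ℤ.+ 1) :* con (ℤ.+ 1) :- con (ℤ.+ 0) :* a)) refl _ ⟩
        0# + (1# * 1# - 0# * 𝟙 d₄)
          ≈⟨ +-cong (sym (𝟙-no (v′ <? v) (ℕP.<-asym v<v′))) (+-cong refl (-‿cong (*-cong (sym (𝟙-no d₃ v≢v′)) refl))) ⟩
        𝟙 (v′ <? v) + (1# * 1# - 𝟙 d₃ * 𝟙 d₄)   ∎
      cases x y d₁ d₂ (yes P.refl) (yes P.refl) = begin
        𝟙 (τ v <? τ v′)                          ≈⟨ 𝟙-no (τ v <? τ v′) (λ h → ℕP.<-asym v<v′ (P.subst₂ _<ᶠ_ τ-v τ-v′ h)) ⟩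
        0#
          ≈⟨ solve 1 (λ a → con (ℤ.+ 0) := con (ℤ.+ 1) :+ (con (ℤ.+ 0) :* a :- con (ℤ.+ 1) :* con (ℤ.+ 1))) refl _ ⟩
        1# + (0# * 𝟙 d₂ - 1# * 1#)
          ≈⟨ +-cong (sym (𝟙-yes (v <? v′) v<v′)) (+-cong (*-cong (sym (𝟙-no d₁ (v≢v′ ∘ P.sym))) refl) refl) ⟩
        𝟙 (v <? v′) + (𝟙 d₁ * 𝟙 d₂ - 1# * 1#)   ∎
      cases x y d₁@(no a) d₂ d₃@(no b) d₄ = apart x y d₁ d₂ d₃ d₄ (a ∘ proj₁) (b ∘ proj₁)
      cases x y d₁@(no a) d₂ d₃@(yes _) d₄@(no b) = apart x y d₁ d₂ d₃ d₄ (a ∘ proj₁) (b ∘ proj₂)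
      cases x y d₁@(yes _) d₂@(no a) d₃@(no b) d₄ = apart x y d₁ d₂ d₃ d₄ (a ∘ proj₂) (b ∘ proj₁)
      cases x y d₁@(yes _) d₂@(no a) d₃@(yes _) d₄@(no b) = apart x y d₁ d₂ d₃ d₄ (a ∘ proj₂) (b ∘ proj₂)

    inversions-after-swap : ∀ (σ : Perm n) → invX X ((σ · t) ⁻¹) ≈ invX X (σ ⁻¹) + signedW (σ ⟨$⟩ʳ v) (σ ⟨$⟩ʳ v′)
    inversions-after-swap σ = begin
      invX X ((σ · t) ⁻¹)                                      ≈⟨ inv-as-ΣΣ ((σ · t) ⁻¹) ⟩
      ΣΣ (λ i j → W i j * 𝟙 (τ (σˡ j) <? τ (σˡ i)))            ≈⟨ ΣΣ-cong (λ i j → *-cong refl (order-change (σˡ i) (σˡ j))) ⟩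
      ΣΣ (λ i j → W i j * (𝟙 (σˡ j <? σˡ i) + E i j))          ≈⟨ trans (ΣΣ-cong (λ i j → distribˡ _ _ _)) (ΣΣ-+ _ _) ⟩
      ΣΣ (λ i j → W i j * 𝟙 (σˡ j <? σˡ i)) + ΣΣ (λ i j → W i j * E i j) ≈⟨ +-cong (sym (inv-as-ΣΣ (σ ⁻¹))) correction ⟩
      invX X (σ ⁻¹) + signedW (σ ⟨$⟩ʳ v) (σ ⟨$⟩ʳ v′)          ∎
      where
      σˡ = σ ⟨$⟩ˡ_
      E : Fin n → Fin n → Carrier
      E i j = 𝟙 (σˡ i ≟ v) * 𝟙 (σˡ j ≟ v′) - 𝟙 (σˡ i ≟ v′) * 𝟙 (σˡ j ≟ v)
      at : ∀ i w → 𝟙 (σˡ i ≟ w) ≈ 𝟙 (σ ⟨$⟩ʳ w ≟ i)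
      at i w = 𝟙-iff (σˡ i ≟ w) (σ ⟨$⟩ʳ w ≟ i) (λ e → P.trans (P.cong (σ ⟨$⟩ʳ_) (P.sym e)) (inverseʳ σ))
                                              (λ e → P.trans (P.cong σˡ (P.sym e)) (inverseˡ σ))
      distribute : ∀ w a b c d → w * (a * b - c * d) ≈ (a * b) * w - (c * d) * w
      distribute = solve 5 (λ w a b c d → w :* (a :* b :- c :* d) := (a :* b) :* w :- (c :* d) :* w) refl
        where open Solver
      correction : ΣΣ (λ i j → W i j * E i j) ≈ signedW (σ ⟨$⟩ʳ v) (σ ⟨$⟩ʳ v′)
      correction = begin
        ΣΣ (λ i j → W i j * E i j)
          ≈⟨ ΣΣ-cong (λ i j → trans (distribute _ _ _ _ _) (+-cong (*-cong (*-cong (at i v) (at j v′)) refl) (-‿cong (*-cong (*-cong (at i v′) (at j v)) refl)))) ⟩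
        ΣΣ (λ i j → (𝟙 (σ ⟨$⟩ʳ v ≟ i) * 𝟙 (σ ⟨$⟩ʳ v′ ≟ j)) * W i j - (𝟙 (σ ⟨$⟩ʳ v′ ≟ i) * 𝟙 (σ ⟨$⟩ʳ v ≟ j)) * W i j)
          ≈⟨ ΣΣ-- _ _ ⟩
        ΣΣ (λ i j → (𝟙 (σ ⟨$⟩ʳ v ≟ i) * 𝟙 (σ ⟨$⟩ʳ v′ ≟ j)) * W i j) - ΣΣ (λ i j → (𝟙 (σ ⟨$⟩ʳ v′ ≟ i) * 𝟙 (σ ⟨$⟩ʳ v ≟ j)) * W i j)
          ≈⟨ +-cong (sift₂ _ _ W) (-‿cong (sift₂ _ _ W)) ⟩
        signedW (σ ⟨$⟩ʳ v) (σ ⟨$⟩ʳ v′) ∎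

    T-transposed : ∀ (H : Fin n → Fin n → Carrier) (x y : Fin n) →
      T H x y ≈ T H (t ⟨$⟩ʳ x) (t ⟨$⟩ʳ y) + ΣSym n (λ σ → signedW (σ ⟨$⟩ʳ v) (σ ⟨$⟩ʳ v′) * H (σ ⟨$⟩ʳ (t ⟨$⟩ʳ x)) (σ ⟨$⟩ʳ (t ⟨$⟩ʳ y)))
    T-transposed H x y = begin
      T H x y
        ≈⟨ pull-right t _ (λ σ ρ e → *-cong (invX⁻¹-resp σ ρ e) (resp-values H x y σ ρ e)) ⟩
      ΣSym n (λ σ → invX X ((σ · t) ⁻¹) * H (σ ⟨$⟩ʳ (t ⟨$⟩ʳ x)) (σ ⟨$⟩ʳ (t ⟨$⟩ʳ y)))
        ≈⟨ ΣR-cong (Sym n) (λ σ → trans (*-cong (inversions-after-swap σ) refl) (distribʳ _ _ _)) ⟩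
      ΣSym n (λ σ → invX X (σ ⁻¹) * H (σ ⟨$⟩ʳ (t ⟨$⟩ʳ x)) (σ ⟨$⟩ʳ (t ⟨$⟩ʳ y))
                   + signedW (σ ⟨$⟩ʳ v) (σ ⟨$⟩ʳ v′) * H (σ ⟨$⟩ʳ (t ⟨$⟩ʳ x)) (σ ⟨$⟩ʳ (t ⟨$⟩ʳ y)))
        ≈⟨ ΣR-+ (Sym n) _ _ ⟩
      T H (t ⟨$⟩ʳ x) (t ⟨$⟩ʳ y) + ΣSym n (λ σ → signedW (σ ⟨$⟩ʳ v) (σ ⟨$⟩ʳ v′) * H (σ ⟨$⟩ʳ (t ⟨$⟩ʳ x)) (σ ⟨$⟩ʳ (t ⟨$⟩ʳ y))) ∎

module Reduction {c ℓ : Level} (R : CommutativeRing c ℓ) {n : ℕ} (X : Fin n → Fin n → CommutativeRing.Carrier R) where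
  open CommutativeRing R hiding (zero)
  open Poly R
  open RingArithmetic R
  open FiniteSums R
  open PermutationFacts
  open SymmetricSums R
  open DoubleSums n
  open Inversions R X
  open import Relation.Binary.Reasoning.Setoid setoid

  L : (Fin n → Fin n → Carrier) → Perm n → Carrier
  L H π = ΣΣ (λ i j → W i j * H (π ⟨$⟩ʳ i) (π ⟨$⟩ʳ j))

  g : Fin n → Fin n → Carrier
  g a b = 𝟙 (b <? a)

  inv-as-L : ∀ π → invX X π ≈ L g π
  inv-as-L = inv-as-ΣΣ

  convolution-L : ∀ (H : Fin n → Fin n → Carrier) π → ΣSym n (λ σ → invX X (σ ⁻¹) * L H (σ · π)) ≈ L (T H) π
  convolution-L H π = begin
    ΣSym n (λ σ → invX X (σ ⁻¹) * L H (σ · π))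
      ≈⟨ ΣR-cong (Sym n) (λ σ → trans (ΣΣ-*ˡ _ _) (ΣΣ-cong (λ i j → exchange _ _ _))) ⟩
    ΣSym n (λ σ → ΣΣ (λ i j → W i j * (invX X (σ ⁻¹) * H (σ ⟨$⟩ʳ (π ⟨$⟩ʳ i)) (σ ⟨$⟩ʳ (π ⟨$⟩ʳ j)))))
      ≈⟨ ΣSym-ΣΣ {n} {n} _ ⟩
    ΣΣ (λ i j → ΣSym n (λ σ → W i j * (invX X (σ ⁻¹) * H (σ ⟨$⟩ʳ (π ⟨$⟩ʳ i)) (σ ⟨$⟩ʳ (π ⟨$⟩ʳ j)))))
      ≈⟨ ΣΣ-cong (λ i j → sym (ΣR-*ˡ (Sym n) _ _)) ⟩
    L (T H) π ∎
    where
    exchange : ∀ a b c → a * (b * c) ≈ b * (a * c)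
    exchange a b c = trans (sym (*-assoc _ _ _)) (trans (*-cong (*-comm _ _) refl) (*-assoc _ _ _))

  f₂-as-L : ∀ π → f₂ X π ≈ L (T g) π
  f₂-as-L π = trans (ΣR-cong (Sym n) (λ σ → *-cong refl (inv-as-L (σ · π)))) (convolution-L g π)

  -- f₃ π = Σ_σ inv_X(σ⁻¹) · f₂(σ π), by the substitution τ = ρ σ in the inner sum
  f₃-as-convolution : ∀ π → f₃ X π ≈ ΣSym n (λ σ → invX X (σ ⁻¹) * f₂ X (σ · π))
  f₃-as-convolution π = ΣR-cong (Sym n) (λ σ → begin
    ΣSym n (λ τ → invX X (σ ⁻¹) * invX X (σ · (τ ⁻¹)) * invX X (τ · π))
      ≈⟨ trans (ΣR-cong (Sym n) (λ τ → *-assoc _ _ _)) (sym (ΣR-*ˡ (Sym n) _ _)) ⟩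
    invX X (σ ⁻¹) * ΣSym n (λ τ → invX X (σ · (τ ⁻¹)) * invX X (τ · π))
      ≈⟨ *-cong refl (pull-right σ _ (resp σ)) ⟩
    invX X (σ ⁻¹) * ΣSym n (λ ρ → invX X (σ · ((ρ · σ) ⁻¹)) * invX X ((ρ · σ) · π))
      ≈⟨ *-cong refl (ΣR-cong (Sym n) (λ ρ → *-cong (invX-resp (σ · ((ρ · σ) ⁻¹)) (ρ ⁻¹) (λ i → inverseʳ σ)) refl)) ⟩
    invX X (σ ⁻¹) * f₂ X (σ · π) ∎)
    where
    resp : ∀ (σ : Perm n) → RespP (λ τ → invX X (σ · (τ ⁻¹)) * invX X (τ · π))
    resp σ τ τ′ e = *-cong (invX-resp (σ · (τ ⁻¹)) (σ · (τ′ ⁻¹)) (λ i → P.cong (σ ⟨$⟩ʳ_) (≈ₚ-inverse {σ = τ} {τ′} e i)))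
                           (invX-resp (τ · π) (τ′ · π) (λ i → e (π ⟨$⟩ʳ i)))

  f₃-as-L : ∀ π → f₃ X π ≈ L (T (T g)) π
  f₃-as-L π = trans (f₃-as-convolution π) (trans (ΣR-cong (Sym n) (λ σ → *-cong refl (f₂-as-L (σ · π)))) (convolution-L (T g) π))

  K : Fin n → Fin n → Carrier
  K x y = (Λ X * Δ X) * g x y + (Λ X + Δ X) * T g x y + T (T g) x y

  f-as-L : ∀ π → f X π ≈ L K π
  f-as-L π = begin
    Λ X * Δ X * invX X π + (Λ X + Δ X) * f₂ X π + f₃ X π
      ≈⟨ +-cong (+-cong (*-cong refl (inv-as-L π)) (*-cong refl (f₂-as-L π))) (f₃-as-L π) ⟩
    (Λ X * Δ X) * L g π + (Λ X + Δ X) * L (T g) π + L (T (T g)) π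
      ≈⟨ +-cong (+-cong (ΣΣ-*ˡ _ _) (ΣΣ-*ˡ _ _)) refl ⟩
    ΣΣ (λ i j → (Λ X * Δ X) * (W i j * g (π ⟨$⟩ʳ i) (π ⟨$⟩ʳ j))) + ΣΣ (λ i j → (Λ X + Δ X) * (W i j * T g (π ⟨$⟩ʳ i) (π ⟨$⟩ʳ j))) + L (T (T g)) π
      ≈⟨ trans (+-cong (sym (ΣΣ-+ _ _)) refl) (sym (ΣΣ-+ _ _)) ⟩
    ΣΣ (λ i j → (Λ X * Δ X) * (W i j * g (π ⟨$⟩ʳ i) (π ⟨$⟩ʳ j)) + (Λ X + Δ X) * (W i j * T g (π ⟨$⟩ʳ i) (π ⟨$⟩ʳ j)) + W i j * T (T g) (π ⟨$⟩ʳ i) (π ⟨$⟩ʳ j))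
      ≈⟨ ΣΣ-cong (λ i j → factor _ _ _ _ _ _) ⟩
    L K π ∎
    where
    factor : ∀ a b w x y z → a * (w * x) + b * (w * y) + w * z ≈ w * (a * x + b * y + z)
    factor = solve 6 (λ a b w x y z → a :* (w :* x) :+ b :* (w :* y) :+ w :* z := w :* (a :* x :+ b :* y :+ z)) refl
      where open Solver

  -- L H π only sees H off the diagonal, so a kernel that is constant
  -- off the diagonal gives a value independent of π
  L-constant : ∀ (H : Fin n → Fin n → Carrier) (κ : Carrier) → (∀ x y → x ≢ y → H x y ≈ κ) → ∀ π → L H π ≈ κ * ΣΣ W
  L-constant H κ H≈κ π = begin
    L H π                  ≈⟨ ΣΣ-cong (λ i j → W-guard i j (λ i<j → H≈κ _ _ (λ e → ℕP.<-irrefl (P.cong toℕ (perm-injective π e)) i<j))) ⟩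
    ΣΣ (λ i j → W i j * κ) ≈⟨ sym (ΣΣ-*ʳ κ W) ⟩
    ΣΣ W * κ               ≈⟨ *-comm _ _ ⟩
    κ * ΣΣ W               ∎

  T-cong : ∀ (H H′ : Fin n → Fin n → Carrier) → (∀ x y → x ≢ y → H x y ≈ H′ x y) → ∀ a b → a ≢ b → T H a b ≈ T H′ a b
  T-cong H H′ e a b a≢b = ΣR-cong (Sym n) (λ σ → *-cong refl (e _ _ (λ q → a≢b (perm-injective σ q))))

  S : Carrier
  S = ΣSym n (λ σ → invX X (σ ⁻¹))

  T-linear : ∀ (α β γ : Carrier) (G₁ G₂ : Fin n → Fin n → Carrier) a b →
             T (λ x y → α + β * G₁ x y + γ * G₂ x y) a b ≈ α * S + β * T G₁ a b + γ * T G₂ a b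
  T-linear α β γ G₁ G₂ a b = begin
    T (λ x y → α + β * G₁ x y + γ * G₂ x y) a b
      ≈⟨ ΣR-cong (Sym n) (λ σ → distribute _ _ _ _ _ _) ⟩
    ΣSym n (λ σ → I σ * α + β * (I σ * G₁ (σ ⟨$⟩ʳ a) (σ ⟨$⟩ʳ b)) + γ * (I σ * G₂ (σ ⟨$⟩ʳ a) (σ ⟨$⟩ʳ b)))
      ≈⟨ trans (ΣR-+ (Sym n) _ _) (+-cong (ΣR-+ (Sym n) _ _) refl) ⟩
    ΣSym n (λ σ → I σ * α) + ΣSym n (λ σ → β * (I σ * G₁ (σ ⟨$⟩ʳ a) (σ ⟨$⟩ʳ b))) + ΣSym n (λ σ → γ * (I σ * G₂ (σ ⟨$⟩ʳ a) (σ ⟨$⟩ʳ b)))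
      ≈⟨ +-cong (+-cong (trans (sym (ΣR-*ʳ (Sym n) _ _)) (*-comm _ _)) (sym (ΣR-*ˡ (Sym n) _ _))) (sym (ΣR-*ˡ (Sym n) _ _)) ⟩
    α * S + β * T G₁ a b + γ * T G₂ a b ∎
    where
    I : Perm n → Carrier
    I σ = invX X (σ ⁻¹)
    distribute : ∀ i a b g₁ c g₂ → i * (a + b * g₁ + c * g₂) ≈ i * a + b * (i * g₁) + c * (i * g₂)
    distribute = solve 6 (λ i a b g₁ c g₂ → i :* (a :+ b :* g₁ :+ c :* g₂) := i :* a :+ b :* (i :* g₁) :+ c :* (i :* g₂)) refl
      where open Solver

  -- the identity has no inversions, which gives the second claim
  inv-identity : invX X ι ≈ 0#
  inv-identity = trans (inv-as-ΣΣ ι) (ΣR-0 (allFin n) (λ i → ΣR-0 (allFin n) (λ j →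
    trans (W-guard i j (λ i<j → 𝟙-no (j <? i) (ℕP.<-asym i<j))) (zeroʳ _))))

  f-at-identity : f X ι ≈ (Λ X + Δ X) * f₂ X ι + f₃ X ι
  f-at-identity = +-cong (trans (+-cong (trans (*-cong refl inv-identity) (zeroʳ _)) refl) (+-identityˡ _)) refl

-- The identities (1) and (2) and the constancy of K, for n = m + 3 (so that
-- (n-2)! = (m+1)! and (n-3)! = m!): evaluation of the correction sums.
module Evaluation {c ℓ : Level} (R : CommutativeRing c ℓ) (m : ℕ)
                  (X : Fin (3 ℕ.+ m) → Fin (3 ℕ.+ m) → CommutativeRing.Carrier R) where
  open CommutativeRing R hiding (zero)
  open Poly R
  open RingArithmetic R
  open FiniteSums R
  open SymmetricSums R
  open Progressions R
  open DoubleSums (3 ℕ.+ m)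
  open Inversions R X
  open Reduction R X
  open import Relation.Binary.Reasoning.Setoid setoid

  n : ℕ
  n = 3 ℕ.+ m

  N : Fin n → Carrier
  N x = natR (toℕ x)

  w : Fin n → Fin n → Carrier
  w a b = N a - N b

  N-difference : ∀ p q → toℕ p ≤ toℕ q → N q ≈ N p + natR (toℕ q ∸ toℕ p)
  N-difference p q p≤q = trans (reflexive (P.cong natR (P.sym (ℕP.m+[n∸m]≡n p≤q)))) (natR-+ (toℕ p) (toℕ q ∸ toℕ p))

  N-gap : ∀ p q → toℕ p ℕ.< toℕ q → N q ≈ N p + (1# + natR (toℕ q ∸ toℕ p ∸ 1))
  N-gap p q p<q = trans (reflexive (P.cong natR (gap (toℕ p) (toℕ q) p<q))) (natR-+ (toℕ p) _)
    where
    gap : ∀ a b → a ℕ.< b → b ≡ a ℕ.+ suc (b ∸ a ∸ 1)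
    gap zero    (suc b) _         = P.refl
    gap (suc a) (suc b) (s≤s a<b) = P.cong suc (gap a b a<b)

  Λsum Bsum Wsum : Carrier
  Λsum = ΣΣ (λ i j → W i j * natR (toℕ j ∸ toℕ i))
  Bsum = ΣΣ (λ i j → W i j * natR (toℕ j ∸ toℕ i ∸ 1))
  Wsum = ΣΣ W

  B : Carrier
  B = natR (m !) * Bsum

  Λ-as-ΣΣ : Λ X ≈ natR (suc m !) * Λsum
  Λ-as-ΣΣ = *-cong refl (Σpairs-weighted _)

  signed-position-sum : ΣΣ (λ p q → signedW p q * N p) ≈ - Λsum
  signed-position-sum = begin
    ΣΣ (λ p q → signedW p q * N p)                  ≈⟨ signedW-sum (λ p q → N p) ⟩
    ΣΣ (λ p q → W p q * (N p - N q))
      ≈⟨ ΣΣ-cong (λ p q → W-guard p q (λ p<q → trans (+-cong refl (-‿cong (N-difference p q (ℕP.<⇒≤ p<q)))) (cancel _ _))) ⟩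
    ΣΣ (λ p q → W p q * - natR (toℕ q ∸ toℕ p))     ≈⟨ ΣΣ-cong (λ p q → sym (-‿distribʳ-* _ _)) ⟩
    ΣΣ (λ p q → - (W p q * natR (toℕ q ∸ toℕ p)))   ≈⟨ ΣΣ-neg _ ⟩
    - Λsum                                          ∎
    where
    cancel : ∀ a d → a - (a + d) ≈ - d
    cancel = solve 2 (λ a d → a :- (a :+ d) := :- d) refl
      where open Solver

  Q : Fin n → Carrier
  Q a = T (λ x _ → N x) a a

  Q-step : ∀ v v′ → toℕ v′ ≡ suc (toℕ v) → Q v′ ≈ Q v + - Λ X
  Q-step v v′ adjacent = begin
    Q v′ ≈⟨ T-transposed H v′ v′ ⟩
    T H (t ⟨$⟩ʳ v′) (t ⟨$⟩ʳ v′) + ΣSym n (λ σ → signedW (σ ⟨$⟩ʳ v) (σ ⟨$⟩ʳ v′) * N (σ ⟨$⟩ʳ (t ⟨$⟩ʳ v′)))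
      ≡⟨ P.cong (λ z → T H z z + ΣSym n (λ σ → signedW (σ ⟨$⟩ʳ v) (σ ⟨$⟩ʳ v′) * N (σ ⟨$⟩ʳ z))) t-v′ ⟩
    Q v + ΣSym n (λ σ → signedW (σ ⟨$⟩ʳ v) (σ ⟨$⟩ʳ v′) * N (σ ⟨$⟩ʳ v))
      ≈⟨ +-cong refl (sum-of-two-values v≢v′ (λ p q → signedW p q * N p) (λ p → trans (*-cong (signedW-diagonal p) refl) (zeroˡ _))) ⟩
    Q v + natR (suc m !) * ΣΣ (λ p q → signedW p q * N p)
      ≈⟨ +-cong refl (trans (*-cong refl signed-position-sum) (trans (sym (-‿distribʳ-* _ _)) (-‿cong (sym Λ-as-ΣΣ)))) ⟩
    Q v + - Λ X ∎
    where
    open Adjacent v v′ adjacent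
    H : Fin n → Fin n → Carrier
    H x _ = N x

  T-w : ∀ a b → T w a b ≈ - Λ X * w a b
  T-w a b = begin
    T w a b ≈⟨ trans (ΣR-cong (Sym n) (λ σ → solve 3 (λ i x y → i :* (x :- y) := i :* x :- i :* y) refl _ _ _)) (ΣR-- (Sym n) _ _) ⟩
    Q a - Q b ≈⟨ +-cong (linear a) (-‿cong (linear b)) ⟩
    (Q zero + N a * - Λ X) - (Q zero + N b * - Λ X)
      ≈⟨ solve 4 (λ q x y l → (q :+ x :* (:- l)) :- (q :+ y :* (:- l)) := (:- l) :* (x :- y)) refl _ _ _ _ ⟩
    - Λ X * w a b ∎
    where
    open Solver
    linear : ∀ x → Q x ≈ Q zero + N x * - Λ X
    linear x = progression Q (- Λ X) zero x z≤n (λ v v′ adj _ _ → Q-step v v′ adj)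

  <-𝟙-irrefl : ∀ (p : Fin n) → 𝟙 (p <? p) ≈ 0#
  <-𝟙-irrefl p = 𝟙-no (p <? p) (ℕP.<-irrefl P.refl)

  <-𝟙-yes : ∀ (p q : Fin n) → toℕ p ℕ.< toℕ q → 𝟙 (p <? q) ≈ 1#
  <-𝟙-yes p q p<q = 𝟙-yes (p <? q) p<q

  <-𝟙-no : ∀ (p q : Fin n) → toℕ p ℕ.< toℕ q → 𝟙 (q <? p) ≈ 0#
  <-𝟙-no p q p<q = 𝟙-no (q <? p) (ℕP.<-asym p<q)

  sum-over-third : ∀ p q (f : Fin n → Carrier) (s : Carrier) → (p ≡ q → s ≈ 0#) →
                   ΣF n (λ r → distinct₃ p q r * (s * f r)) ≈ s * ((ΣF n f - f p) - f q)
  sum-over-third p q f s s-diagonal = begin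
    ΣF n (λ r → distinct₃ p q r * (s * f r))                  ≈⟨ ΣR-cong (allFin n) (λ r → regroup _ _ _ _ _) ⟩
    ΣF n (λ r → (𝟙≢ p q * s) * ((𝟙≢ p r * 𝟙≢ q r) * f r))     ≈⟨ sym (ΣR-*ˡ (allFin n) _ _) ⟩
    (𝟙≢ p q * s) * ΣF n (λ r → (𝟙≢ p r * 𝟙≢ q r) * f r)       ≈⟨ cases (p ≟ q) ⟩
    s * ((ΣF n f - f p) - f q)                                ∎
    where
    regroup : ∀ a b c s x → (a * (b * c)) * (s * x) ≈ (a * s) * ((b * c) * x)
    regroup = solve 5 (λ a b c s x → (a :* (b :* c)) :* (s :* x) := (a :* s) :* ((b :* c) :* x)) refl
      where open Solver
    cases : Dec (p ≡ q) → (𝟙≢ p q * s) * ΣF n (λ r → (𝟙≢ p r * 𝟙≢ q r) * f r) ≈ s * ((ΣF n f - f p) - f q)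
    cases (yes e)   = trans (*-cong (trans (*-cong refl (s-diagonal e)) (zeroʳ _)) refl)
                        (trans (zeroˡ _) (sym (trans (*-cong (s-diagonal e) refl) (zeroˡ _))))
    cases (no p≢q) = *-cong (trans (*-cong (𝟙-yes (¬? (p ≟ q)) p≢q) refl) (*-identityˡ _)) (Σ-avoiding p q p≢q f)

  correction-below : ΣΣ (λ p q → ΣF n (λ r → distinct₃ p q r * (signedW p q * 𝟙 (r <? p)))) ≈ - Bsum
  correction-below = begin
    ΣΣ (λ p q → ΣF n (λ r → distinct₃ p q r * (signedW p q * 𝟙 (r <? p))))
      ≈⟨ ΣΣ-cong (λ p q → trans (sum-over-third p q (λ r → 𝟙 (r <? p)) (signedW p q) (λ { P.refl → signedW-diagonal p }))
                                 (*-cong refl (+-cong (+-cong (count-below p) refl) refl))) ⟩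
    ΣΣ (λ p q → signedW p q * F p q)            ≈⟨ signedW-sum F ⟩
    ΣΣ (λ p q → W p q * (F p q - F q p))         ≈⟨ ΣΣ-cong (λ p q → W-guard p q (difference p q)) ⟩
    ΣΣ (λ p q → W p q * - natR (toℕ q ∸ toℕ p ∸ 1)) ≈⟨ trans (ΣΣ-cong (λ p q → sym (-‿distribʳ-* _ _))) (ΣΣ-neg _) ⟩
    - Bsum ∎
    where
    F : Fin n → Fin n → Carrier
    F p q = (N p - 𝟙 (p <? p)) - 𝟙 (q <? p)
    simplify : ∀ a d → ((a - 0#) - 0#) - (((a + (1# + d)) - 0#) - 1#) ≈ - d
    simplify = solve 2 (λ a d → ((a :- con (ℤ.+ 0)) :- con (ℤ.+ 0)) :- (((a :+ (con (ℤ.+ 1) :+ d)) :- con (ℤ.+ 0)) :- con (ℤ.+ 1)) := :- d) refl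
      where open Solver
    difference : ∀ p q → toℕ p ℕ.< toℕ q → F p q - F q p ≈ - natR (toℕ q ∸ toℕ p ∸ 1)
    difference p q p<q = trans (+-cong (+-cong (+-cong refl (-‿cong (<-𝟙-irrefl p))) (-‿cong (<-𝟙-no p q p<q)))
                                (-‿cong (+-cong (+-cong (N-gap p q p<q) (-‿cong (<-𝟙-irrefl q))) (-‿cong (<-𝟙-yes p q p<q))))) (simplify _ _)

  correction-above : ΣΣ (λ p q → ΣF n (λ r → distinct₃ p q r * (signedW p q * 𝟙 (p <? r)))) ≈ Bsum
  correction-above = begin
    ΣΣ (λ p q → ΣF n (λ r → distinct₃ p q r * (signedW p q * 𝟙 (p <? r))))
      ≈⟨ ΣΣ-cong (λ p q → trans (sum-over-third p q (λ r → 𝟙 (p <? r)) (signedW p q) (λ { P.refl → signedW-diagonal p }))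
                                 (*-cong refl (+-cong (+-cong (count-above p) refl) refl))) ⟩
    ΣΣ (λ p q → signedW p q * F p q)      ≈⟨ signedW-sum F ⟩
    ΣΣ (λ p q → W p q * (F p q - F q p))  ≈⟨ ΣΣ-cong (λ p q → W-guard p q (difference p q)) ⟩
    Bsum ∎
    where
    F : Fin n → Fin n → Carrier
    F p q = ((natR n - (1# + N p)) - 𝟙 (p <? p)) - 𝟙 (p <? q)
    simplify : ∀ k a d → ((k - (1# + a)) - 0#) - 1# - (((k - (1# + (a + (1# + d)))) - 0#) - 0#) ≈ d
    simplify = solve 3 (λ k a d → ((k :- (con (ℤ.+ 1) :+ a)) :- con (ℤ.+ 0)) :- con (ℤ.+ 1)
                                  :- (((k :- (con (ℤ.+ 1) :+ (a :+ (con (ℤ.+ 1) :+ d)))) :- con (ℤ.+ 0)) :- con (ℤ.+ 0)) := d) refl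
      where open Solver
    difference : ∀ p q → toℕ p ℕ.< toℕ q → F p q - F q p ≈ natR (toℕ q ∸ toℕ p ∸ 1)
    difference p q p<q = trans (+-cong (+-cong (+-cong refl (-‿cong (<-𝟙-irrefl p))) (-‿cong (<-𝟙-yes p q p<q)))
                                (-‿cong (+-cong (+-cong (+-cong refl (-‿cong (+-cong refl (N-gap p q p<q)))) (-‿cong (<-𝟙-irrefl q))) (-‿cong (<-𝟙-no p q p<q))))) (simplify _ _ _)

  correction-pair : ΣΣ (λ p q → signedW p q * 𝟙 (q <? p)) ≈ - Wsum
  correction-pair = begin
    ΣΣ (λ p q → signedW p q * 𝟙 (q <? p))            ≈⟨ signedW-sum (λ p q → 𝟙 (q <? p)) ⟩
    ΣΣ (λ p q → W p q * (𝟙 (q <? p) - 𝟙 (p <? q)))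
      ≈⟨ ΣΣ-cong (λ p q → W-guard p q (λ p<q → trans (+-cong (<-𝟙-no p q p<q) (-‿cong (<-𝟙-yes p q p<q))) (+-identityˡ _))) ⟩
    ΣΣ (λ p q → W p q * - 1#)                       ≈⟨ ΣΣ-cong (λ p q → trans (sym (-‿distribʳ-* _ _)) (-‿cong (*-identityʳ _))) ⟩
    ΣΣ (λ p q → - W p q)                            ≈⟨ ΣΣ-neg W ⟩
    - Wsum ∎

  -- Δ + 2B = (n-2)! Σ W, since (n − 2(j−i)) + 2(j−i−1) = n − 2 for i < j
  Δ-relation : Δ X + (B + B) ≈ natR (suc m !) * Wsum
  Δ-relation = begin
    Δ X + (B + B)                                   ≈⟨ +-cong (*-cong refl (Σpairs-weighted _)) (sym (distribˡ _ _ _)) ⟩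
    natR (m !) * ΣΣ (λ i j → W i j * I i j) + natR (m !) * (Bsum + Bsum)  ≈⟨ sym (distribˡ _ _ _) ⟩
    natR (m !) * (ΣΣ (λ i j → W i j * I i j) + (Bsum + Bsum))
      ≈⟨ *-cong refl (trans (+-cong refl (sym (ΣΣ-+ _ _))) (sym (ΣΣ-+ _ _))) ⟩
    natR (m !) * ΣΣ (λ i j → W i j * I i j + (W i j * natR (gap i j) + W i j * natR (gap i j)))
      ≈⟨ *-cong refl (ΣΣ-cong (λ i j → trans (sym (trans (distribˡ _ _ _) (+-cong refl (distribˡ _ _ _)))) (W-guard i j (per-pair i j)))) ⟩
    natR (m !) * ΣΣ (λ i j → W i j * natR (suc m))  ≈⟨ *-cong refl (sym (ΣΣ-*ʳ _ W)) ⟩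
    natR (m !) * (Wsum * natR (suc m))              ≈⟨ solve 3 (λ a b c → a :* (b :* c) := (c :* a) :* b) refl _ _ _ ⟩
    (natR (suc m) * natR (m !)) * Wsum              ≈⟨ *-cong (sym (natR-* (suc m) (m !))) refl ⟩
    natR (suc m !) * Wsum                           ∎
    where
    open Solver
    gap : Fin n → Fin n → ℕ
    gap i j = toℕ j ∸ toℕ i ∸ 1
    I : Fin n → Fin n → Carrier
    I i j = intR (ℤ.+ n ℤ.- (ℤ.+ 2 ℤ.* ℤ.+ (toℕ j ∸ toℕ i)))
    I-value : ∀ i j → I i j ≈ natR n - natR 2 * natR (toℕ j ∸ toℕ i)
    I-value i j = trans (intR-+ (ℤ.+ n) (ℤ.- d)) (+-cong refl (trans (intR-neg d) (-‿cong (intR-* (ℤ.+ 2) (ℤ.+ (toℕ j ∸ toℕ i))))))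
      where d = ℤ.+ 2 ℤ.* ℤ.+ (toℕ j ∸ toℕ i)
    simplify : ∀ a e → ((1# + (1# + (1# + a))) - (1# + (1# + 0#)) * (1# + e)) + (e + e) ≈ 1# + a
    simplify = solve 2 (λ a e → ((con (ℤ.+ 1) :+ (con (ℤ.+ 1) :+ (con (ℤ.+ 1) :+ a))) :- (con (ℤ.+ 1) :+ (con (ℤ.+ 1) :+ con (ℤ.+ 0))) :* (con (ℤ.+ 1) :+ e)) :+ (e :+ e)
                             := con (ℤ.+ 1) :+ a) refl
    pred-gap : ∀ a b → a ℕ.< b → b ∸ a ≡ suc (b ∸ a ∸ 1)
    pred-gap zero    (suc b) _         = P.refl
    pred-gap (suc a) (suc b) (s≤s a<b) = pred-gap a b a<b
    per-pair : ∀ i j → toℕ i ℕ.< toℕ j → I i j + (natR (gap i j) + natR (gap i j)) ≈ natR (suc m)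
    per-pair i j i<j = trans (+-cong (trans (I-value i j) (+-cong refl (-‿cong (*-cong refl (reflexive (P.cong natR (pred-gap (toℕ i) (toℕ j) i<j))))))) refl)
                             (simplify _ _)

  E : Fin n → Fin n → Carrier
  E a b = T g a b + Δ X * g a b + B * w a b

  E-move-first : ∀ v v′ → toℕ v′ ≡ suc (toℕ v) → ∀ b → b ≢ v → b ≢ v′ → E v′ b ≈ E v b
  E-move-first v v′ adjacent b b≢v b≢v′ = begin
    T g v′ b + Δ X * g v′ b + B * w v′ b
      ≈⟨ +-cong (+-cong T-step (*-cong refl g-step)) (*-cong refl (+-cong (reflexive (P.cong natR adjacent)) refl)) ⟩
    (T g v b + - B) + Δ X * g v b + B * ((1# + N v) - N b)
      ≈⟨ solve 6 (λ tg b d gg a c → (tg :+ :- b) :+ d :* gg :+ b :* ((con (ℤ.+ 1) :+ a) :- c) := tg :+ d :* gg :+ b :* (a :- c)) refl _ _ _ _ _ _ ⟩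
    T g v b + Δ X * g v b + B * w v b ∎
    where
    open Solver
    open Adjacent v v′ adjacent
    T-step : T g v′ b ≈ T g v b + - B
    T-step = begin
      T g v′ b ≈⟨ T-transposed g v′ b ⟩
      T g (t ⟨$⟩ʳ v′) (t ⟨$⟩ʳ b) + ΣSym n (λ σ → signedW (σ ⟨$⟩ʳ v) (σ ⟨$⟩ʳ v′) * g (σ ⟨$⟩ʳ (t ⟨$⟩ʳ v′)) (σ ⟨$⟩ʳ (t ⟨$⟩ʳ b)))
        ≡⟨ P.cong₂ (λ x y → T g x y + ΣSym n (λ σ → signedW (σ ⟨$⟩ʳ v) (σ ⟨$⟩ʳ v′) * g (σ ⟨$⟩ʳ x) (σ ⟨$⟩ʳ y))) t-v′ (t-fixes b b≢v b≢v′) ⟩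
      T g v b + ΣSym n (λ σ → signedW (σ ⟨$⟩ʳ v) (σ ⟨$⟩ʳ v′) * g (σ ⟨$⟩ʳ v) (σ ⟨$⟩ʳ b))
        ≈⟨ +-cong refl (sum-of-three-values v≢v′ (b≢v ∘ P.sym) (b≢v′ ∘ P.sym) (λ p q r → signedW p q * g p r)) ⟩
      T g v b + natR (m !) * ΣΣ (λ p q → ΣF n (λ r → distinct₃ p q r * (signedW p q * 𝟙 (r <? p))))
        ≈⟨ +-cong refl (trans (*-cong refl correction-below) (sym (-‿distribʳ-* _ _))) ⟩
      T g v b + - B ∎
    -- b lies on the same side of v and v′
    g-step : g v′ b ≈ g v b
    g-step = 𝟙-iff (b <? v′) (b <? v)
      (λ b<v′ → ℕP.≤∧≢⇒< (ℕP.m<1+n⇒m≤n (P.subst (toℕ b ℕ.<_) adjacent b<v′)) (λ e → b≢v (FinP.toℕ-injective e)))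
      (λ b<v → ℕP.<-trans b<v v<v′)

  E-move-second : ∀ v v′ → toℕ v′ ≡ suc (toℕ v) → ∀ a → a ≢ v → a ≢ v′ → E a v′ ≈ E a v
  E-move-second v v′ adjacent a a≢v a≢v′ = begin
    T g a v′ + Δ X * g a v′ + B * w a v′
      ≈⟨ +-cong (+-cong T-step (*-cong refl g-step)) (*-cong refl (+-cong refl (-‿cong (reflexive (P.cong natR adjacent))))) ⟩
    (T g a v + B) + Δ X * g a v + B * (N a - (1# + N v))
      ≈⟨ solve 6 (λ tg b d gg a c → (tg :+ b) :+ d :* gg :+ b :* (a :- (con (ℤ.+ 1) :+ c)) := tg :+ d :* gg :+ b :* (a :- c)) refl _ _ _ _ _ _ ⟩
    T g a v + Δ X * g a v + B * w a v ∎
    where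
    open Solver
    open Adjacent v v′ adjacent
    T-step : T g a v′ ≈ T g a v + B
    T-step = begin
      T g a v′ ≈⟨ T-transposed g a v′ ⟩
      T g (t ⟨$⟩ʳ a) (t ⟨$⟩ʳ v′) + ΣSym n (λ σ → signedW (σ ⟨$⟩ʳ v) (σ ⟨$⟩ʳ v′) * g (σ ⟨$⟩ʳ (t ⟨$⟩ʳ a)) (σ ⟨$⟩ʳ (t ⟨$⟩ʳ v′)))
        ≡⟨ P.cong₂ (λ x y → T g x y + ΣSym n (λ σ → signedW (σ ⟨$⟩ʳ v) (σ ⟨$⟩ʳ v′) * g (σ ⟨$⟩ʳ x) (σ ⟨$⟩ʳ y))) (t-fixes a a≢v a≢v′) t-v′ ⟩
      T g a v + ΣSym n (λ σ → signedW (σ ⟨$⟩ʳ v) (σ ⟨$⟩ʳ v′) * g (σ ⟨$⟩ʳ a) (σ ⟨$⟩ʳ v))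
        ≈⟨ +-cong refl (sum-of-three-values v≢v′ (a≢v ∘ P.sym) (a≢v′ ∘ P.sym) (λ p q r → signedW p q * g r p)) ⟩
      T g a v + natR (m !) * ΣΣ (λ p q → ΣF n (λ r → distinct₃ p q r * (signedW p q * 𝟙 (p <? r))))
        ≈⟨ +-cong refl (*-cong refl correction-above) ⟩
      T g a v + B ∎
    -- a lies on the same side of v and v′
    g-step : g a v′ ≈ g a v
    g-step = 𝟙-iff (v′ <? a) (v <? a)
      (λ v′<a → ℕP.<-trans v<v′ v′<a)
      (λ v<a → ℕP.≤∧≢⇒< (P.subst (ℕ._≤ toℕ a) (P.sym adjacent) v<a) (λ e → a≢v′ (FinP.toℕ-injective (P.sym e))))

  E-swap : ∀ v v′ → toℕ v′ ≡ suc (toℕ v) → E v′ v ≈ E v v′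
  E-swap v v′ adjacent = begin
    T g v′ v + Δ X * g v′ v + B * w v′ v
      ≈⟨ +-cong (+-cong T-step (*-cong refl (𝟙-yes (v <? v′) v<v′))) (*-cong refl (+-cong (reflexive (P.cong natR adjacent)) refl)) ⟩
    (T g v v′ + - (Δ X + (B + B))) + Δ X * 1# + B * ((1# + N v) - N v)
      ≈⟨ solve 4 (λ tg d b a → (tg :+ :- (d :+ (b :+ b))) :+ d :* con (ℤ.+ 1) :+ b :* ((con (ℤ.+ 1) :+ a) :- a)
                            := tg :+ d :* con (ℤ.+ 0) :+ b :* (a :- (con (ℤ.+ 1) :+ a))) refl _ _ _ _ ⟩
    T g v v′ + Δ X * 0# + B * (N v - (1# + N v))
      ≈⟨ sym (+-cong (+-cong refl (*-cong refl (𝟙-no (v′ <? v) (ℕP.<-asym v<v′)))) (*-cong refl (+-cong refl (-‿cong (reflexive (P.cong natR adjacent)))))) ⟩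
    T g v v′ + Δ X * g v v′ + B * w v v′ ∎
    where
    open Solver
    open Adjacent v v′ adjacent
    T-step : T g v′ v ≈ T g v v′ + - (Δ X + (B + B))
    T-step = begin
      T g v′ v ≈⟨ T-transposed g v′ v ⟩
      T g (t ⟨$⟩ʳ v′) (t ⟨$⟩ʳ v) + ΣSym n (λ σ → signedW (σ ⟨$⟩ʳ v) (σ ⟨$⟩ʳ v′) * g (σ ⟨$⟩ʳ (t ⟨$⟩ʳ v′)) (σ ⟨$⟩ʳ (t ⟨$⟩ʳ v)))
        ≡⟨ P.cong₂ (λ x y → T g x y + ΣSym n (λ σ → signedW (σ ⟨$⟩ʳ v) (σ ⟨$⟩ʳ v′) * g (σ ⟨$⟩ʳ x) (σ ⟨$⟩ʳ y))) t-v′ t-v ⟩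
      T g v v′ + ΣSym n (λ σ → signedW (σ ⟨$⟩ʳ v) (σ ⟨$⟩ʳ v′) * g (σ ⟨$⟩ʳ v) (σ ⟨$⟩ʳ v′))
        ≈⟨ +-cong refl (sum-of-two-values v≢v′ (λ p q → signedW p q * g p q) (λ p → trans (*-cong (signedW-diagonal p) refl) (zeroˡ _))) ⟩
      T g v v′ + natR (suc m !) * ΣΣ (λ p q → signedW p q * 𝟙 (q <? p))
        ≈⟨ +-cong refl (trans (*-cong refl correction-pair) (trans (sym (-‿distribʳ-* _ _)) (-‿cong (sym Δ-relation)))) ⟩
      T g v v′ + - (Δ X + (B + B)) ∎

  avoids-above : ∀ {v v′ : Fin n} (d : Fin n) → toℕ v′ ≡ suc (toℕ v) → toℕ v′ ℕ.< toℕ d → d ≢ v × d ≢ v′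
  avoids-above d adjacent v′<d =
    (λ e → ℕP.<-irrefl (P.cong toℕ (P.sym e)) (ℕP.<-trans (ℕP.≤-reflexive (P.sym adjacent)) v′<d)) ,
    (λ e → ℕP.<-irrefl (P.cong toℕ (P.sym e)) v′<d)

  avoids-zero : ∀ {v v′ : Fin n} → toℕ v′ ≡ suc (toℕ v) → 1 ≤ toℕ v → zero ≢ v × zero ≢ v′
  avoids-zero adjacent 1≤v =
    (λ e → ℕP.<-irrefl (P.cong toℕ e) 1≤v) ,
    (λ e → ℕP.0≢1+n (P.trans (P.cong toℕ e) adjacent))

  -- hence E is constant off the diagonal: move the smaller argument to 0,
  -- then the larger one to 1 (swapping 1 and 0 if needed)
  E-constant : ∀ a b → a ≢ b → E a b ≈ E zero (suc zero)
  E-constant a b a≢b with ℕP.<-cmp (toℕ a) (toℕ b)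
  ... | tri≈ _ a≡b _ = ⊥-elim (a≢b (FinP.toℕ-injective a≡b))
  ... | tri< a<b _ _ = begin
    E a b           ≈⟨ constant-between (λ x → E x b) zero a z≤n (λ v v′ adj _ v′≤a →
                         let (b≢v , b≢v′) = avoids-above b adj (ℕP.≤-<-trans v′≤a a<b) in E-move-first v v′ adj b b≢v b≢v′) ⟩
    E zero b        ≈⟨ constant-between (λ y → E zero y) (suc zero) b (ℕP.≤-<-trans z≤n a<b) (λ v v′ adj 1≤v _ →
                         let (0≢v , 0≢v′) = avoids-zero adj 1≤v in E-move-second v v′ adj zero 0≢v 0≢v′) ⟩
    E zero (suc zero) ∎
  ... | tri> _ _ b<a = begin
    E a b           ≈⟨ constant-between (λ y → E a y) zero b z≤n (λ v v′ adj _ v′≤b →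
                         let (a≢v , a≢v′) = avoids-above a adj (ℕP.≤-<-trans v′≤b b<a) in E-move-second v v′ adj a a≢v a≢v′) ⟩
    E a zero        ≈⟨ constant-between (λ x → E x zero) (suc zero) a (ℕP.≤-<-trans z≤n b<a) (λ v v′ adj 1≤v _ →
                         let (0≢v , 0≢v′) = avoids-zero adj 1≤v in E-move-first v v′ adj zero 0≢v 0≢v′) ⟩
    E (suc zero) zero ≈⟨ E-swap zero (suc zero) P.refl ⟩
    E zero (suc zero) ∎

  E₀ : Carrier
  E₀ = E zero (suc zero)

  T-g : ∀ a b → a ≢ b → T g a b ≈ E₀ + (- Δ X) * g a b + (- B) * w a b
  T-g a b a≢b = trans (isolate _ _ _ _ _) (+-cong (+-cong (E-constant a b a≢b) refl) refl)
    where
    isolate : ∀ t d gg b ww → t ≈ (t + d * gg + b * ww) + (- d) * gg + (- b) * ww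
    isolate = solve 5 (λ t d gg b ww → t := (t :+ d :* gg :+ b :* ww) :+ (:- d) :* gg :+ (:- b) :* ww) refl
      where open Solver

  κ : Carrier
  κ = E₀ * S + Λ X * E₀

  K-constant : ∀ x y → x ≢ y → K x y ≈ κ
  K-constant x y x≢y = begin
    (Λ X * Δ X) * g x y + (Λ X + Δ X) * T g x y + T (T g) x y
      ≈⟨ +-cong refl (trans (T-cong (T g) (λ a b → E₀ + (- Δ X) * g a b + (- B) * w a b) T-g x y x≢y) (T-linear E₀ (- Δ X) (- B) g w x y)) ⟩
    (Λ X * Δ X) * g x y + (Λ X + Δ X) * T g x y + (E₀ * S + (- Δ X) * T g x y + (- B) * T w x y)
      ≈⟨ +-cong (+-cong refl (*-cong refl (T-g x y x≢y))) (+-cong (+-cong refl (*-cong refl (T-g x y x≢y))) (*-cong refl (T-w x y))) ⟩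
    (Λ X * Δ X) * g x y + (Λ X + Δ X) * (E₀ + (- Δ X) * g x y + (- B) * w x y)
      + (E₀ * S + (- Δ X) * (E₀ + (- Δ X) * g x y + (- B) * w x y) + (- B) * (- Λ X * w x y))
      ≈⟨ collapse _ _ _ _ _ _ _ ⟩
    κ ∎
    where
    collapse : ∀ l d gg e b ww s → (l * d) * gg + (l + d) * (e + (- d) * gg + (- b) * ww)
                                   + (e * s + (- d) * (e + (- d) * gg + (- b) * ww) + (- b) * (- l * ww)) ≈ e * s + l * e
    collapse = solve 7 (λ l d gg e b ww s → (l :* d) :* gg :+ (l :+ d) :* (e :+ (:- d) :* gg :+ (:- b) :* ww)
                          :+ (e :* s :+ (:- d) :* (e :+ (:- d) :* gg :+ (:- b) :* ww) :+ (:- b) :* ((:- l) :* ww)) := e :* s :+ l :* e) refl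
      where open Solver

  f-constant : ∀ π → f X π ≈ κ * Wsum
  f-constant π = trans (f-as-L π) (L-constant K κ K-constant π)

theorem : ∀ {c ℓ} (R : CommutativeRing c ℓ) (m : ℕ) (X : Fin (3 ℕ.+ m) → Fin (3 ℕ.+ m) → CommutativeRing.Carrier R) →
          (π : Permutation′ (3 ℕ.+ m)) →
          let open CommutativeRing R
              open Poly R
          in (f X π ≈ f X ι) × (f X ι ≈ (Λ X + Δ X) * f₂ X ι + f₃ X ι)
theorem R m X π = trans (f-constant π) (sym (f-constant ι)) , f-at-identity
  where
  open CommutativeRing R
  open Evaluation R m X
  open Reduction R X

lemma4p7 : ∀ {c ℓ} (R : CommutativeRing c ℓ) (n : ℕ) → 4 ≤ n →
    (X : Fin n → Fin n → CommutativeRing.Carrier R) → (π : Permutation′ n) →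
    let open CommutativeRing R
        open Poly R
    in (f X π ≈ f X ι) × (f X ι ≈ (Λ X + Δ X) * f₂ X ι + f₃ X ι)
lemma4p7 R .(suc (suc (suc (suc k)))) (s≤s (s≤s (s≤s (s≤s (z≤n {k}))))) X π = theorem R (suc k) X π
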